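{- Let $J$ be a matching covered graph with minimum degree $\delta(J)\ge 3$, let $G$ be a matching covered graph, let $H$ be a conformal subgraph of $G$ that is a bisubdivision of $J$, and let $C=\partial(X)$ be a nontrivial tight cut of $G$. If the shore $\overline{X}=V(G)-X$ contains at most one branch vertex of $H$, then $G/\overline{X}$ is $J$-based.
   Context: Graphs loopless; multiple edges allowed. A connected graph with at least two vertices is matching covered if every edge lies in a perfect matching. A subgraph $H$ of $G$ is conformal if $G-V(H)$ has a perfect matching; a bisubdivision of $J$ is obtained by replacing some edges of $J$ by paths with an even number of internal vertices; the branch vertices of $H$ are its vertices of degree at least three. $\partial(X)$ is the set of edges with exactly one end in $X$; it is tight if every perfect matching contains exactly one of its edges, and nontrivial if both $X$ and $\overline X$ have at least two vertices. $G/\overline{X}$ is obtained by shrinking $\overline{X}$ to a single vertex. A matching covered graph is $J$-based if it has a conformal subgraph that is a bisubdivision of $J$. -}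

module Defs where

open import Data.Bool using (Bool; true; false; _∨_)
open import Data.Nat using (ℕ; suc; _*_)
open import Data.Fin using (Fin)
open import Data.Unit using (⊤)
open import Data.Maybe using (Maybe; just; nothing)
open import Data.Maybe.Properties using (just-injective)
open import Data.Product using (Σ; ∃; _×_; _,_; proj₁; proj₂)
open import Data.Sum using (_⊎_)
open import Data.List using (List; []; _∷_; length)
open import Data.List.Membership.Propositional using (_∈_)
open import Data.List.Relation.Unary.Unique.Propositional using (Unique)
open import Relation.Nullary using (¬_)
open import Relation.Binary.PropositionalEquality using (_≡_; _≢_; refl; cong)

-- Loopless multigraphs: a vertex type V, an edge type E, and an
-- endpoint map (parallel edges allowed; loops forbidden).

record Graph (V E : Set) : Set where
  field
    ends     : E → V × V
    loopless : ∀ e → proj₁ (ends e) ≢ proj₂ (ends e)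
open Graph public

module _ {V E : Set} (G : Graph V E) where

  Incident : E → V → Set
  Incident e v = (proj₁ (ends G e) ≡ v) ⊎ (proj₂ (ends G e) ≡ v)

  Joins : E → V → V → Set
  Joins e u w = (ends G e ≡ (u , w)) ⊎ (ends G e ≡ (w , u))

  data Walk : V → V → Set where
    []    : ∀ {v} → Walk v v
    step  : ∀ {u w z} (e : E) → Joins e u w → Walk w z → Walk u z

  walkEdges : ∀ {u v} → Walk u v → List E
  walkEdges []            = []
  walkEdges (step e _ p)  = e ∷ walkEdges p

  walkVerts : ∀ {u v} → Walk u v → List V
  walkVerts {u} []        = u ∷ []
  walkVerts {u} (step e _ p) = u ∷ walkVerts p

  initVerts : ∀ {u v} → Walk u v → List V
  initVerts []               = []
  initVerts {u} (step e _ p) = u ∷ initVerts p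

  innerVerts : ∀ {u v} → Walk u v → List V
  innerVerts []           = []
  innerVerts (step e _ p) = initVerts p

  IsPath : ∀ {u v} → Walk u v → Set
  IsPath p = Unique (walkVerts p)

  Connected : Set
  Connected = ∀ u v → Walk u v

  ExactlyOne : (E → Set) → Set
  ExactlyOne P = Σ E λ e → P e × (∀ e' → P e' → e' ≡ e)

  IsPerfectMatching : (E → Bool) → Set
  IsPerfectMatching M = ∀ v → ExactlyOne (λ e → (M e ≡ true) × Incident e v)

  MatchingCovered : Set
  MatchingCovered =
    (Σ V λ u → Σ V λ w → u ≢ w) ×
    Connected ×
    (∀ e → Σ (E → Bool) λ M → IsPerfectMatching M × (M e ≡ true))

  ThreeIncident : (E → Set) → V → Set
  ThreeIncident P v =
    Σ E λ e₁ → Σ E λ e₂ → Σ E λ e₃ →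
      (e₁ ≢ e₂) × (e₁ ≢ e₃) × (e₂ ≢ e₃) ×
      (P e₁ × Incident e₁ v) × (P e₂ × Incident e₂ v) × (P e₃ × Incident e₃ v)

  MinDegree≥3 : Set
  MinDegree≥3 = ∀ v → ThreeIncident (λ _ → ⊤) v

  record Subgraph : Set₁ where
    field
      VH : V → Set
      EH : E → Set
      closed : ∀ e → EH e → VH (proj₁ (ends G e)) × VH (proj₂ (ends G e))
  open Subgraph public

  Branch : Subgraph → V → Set
  Branch H v = VH H v × ThreeIncident (EH H) v

  -- H is conformal: G - V(H) has a perfect matching
  Conformal : Subgraph → Set
  Conformal H =
    Σ (E → Bool) λ M →
      (∀ e → M e ≡ true → ¬ VH H (proj₁ (ends G e)) × ¬ VH H (proj₂ (ends G e))) ×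
      (∀ v → ¬ VH H v → ExactlyOne (λ e → (M e ≡ true) × Incident e v))

  record BisubdivisionData {VJ EJ : Set} (J : Graph VJ EJ) (H : Subgraph) : Set where
    field
      φ      : VJ → V
      φ-inj  : ∀ a b → φ a ≡ φ b → a ≡ b
      path   : (f : EJ) → Walk (φ (proj₁ (ends J f))) (φ (proj₂ (ends J f)))
      isPath : ∀ f → IsPath (path f)
      odd    : ∀ f → Σ ℕ λ k → length (walkEdges (path f)) ≡ suc (2 * k)
      inner-not-branch : ∀ f a → ¬ (φ a ∈ innerVerts (path f))
      inner-disjoint   : ∀ f f' v → f ≢ f' →
                           v ∈ innerVerts (path f) → ¬ (v ∈ innerVerts (path f'))
      edge-disjoint    : ∀ f f' e → f ≢ f' →
                           e ∈ walkEdges (path f) → ¬ (e ∈ walkEdges (path f'))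
      vertices : ∀ v → VH H v →
                   (Σ VJ λ a → φ a ≡ v) ⊎ (Σ EJ λ f → v ∈ innerVerts (path f))
      vertices-image : ∀ a → VH H (φ a)
      vertices-inner : ∀ f v → v ∈ innerVerts (path f) → VH H v
      edges   : ∀ e → EH H e → Σ EJ λ f → e ∈ walkEdges (path f)
      edges-image : ∀ f e → e ∈ walkEdges (path f) → EH H e

  IsBisubdivisionOf : Subgraph → {VJ EJ : Set} → Graph VJ EJ → Set
  IsBisubdivisionOf H J = BisubdivisionData J H

  JBased : {VJ EJ : Set} → Graph VJ EJ → Set₁
  JBased J = Σ Subgraph λ H → Conformal H × IsBisubdivisionOf H J

  InCut : (V → Bool) → E → Set
  InCut X e = X (proj₁ (ends G e)) ≢ X (proj₂ (ends G e))

  TightCut : (V → Bool) → Set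
  TightCut X = ∀ M → IsPerfectMatching M → ExactlyOne (λ e → (M e ≡ true) × InCut X e)

  NontrivialCut : (V → Bool) → Set
  NontrivialCut X =
    (Σ V λ a → Σ V λ b → a ≢ b × X a ≡ true × X b ≡ true) ×
    (Σ V λ a → Σ V λ b → a ≢ b × X a ≡ false × X b ≡ false)

  -- G / X̄ : shrink the complement of X to a single vertex (nothing);
  -- edges with both ends in X̄ would become loops and are deleted.
  module Shrink (X : V → Bool) where
    V' : Set
    V' = Maybe (Σ V λ v → X v ≡ true)

    E' : Set
    E' = Σ E λ e → X (proj₁ (ends G e)) ∨ X (proj₂ (ends G e)) ≡ true

    shrAux : (v : V) (b : Bool) → X v ≡ b → V'
    shrAux v true  p = just (v , p)
    shrAux v false _ = nothing

    shr : V → V'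
    shr v = shrAux v (X v) refl

    noLoop : ∀ u w → u ≢ w → (b c : Bool) (p : X u ≡ b) (q : X w ≡ c) →
             b ∨ c ≡ true → shrAux u b p ≢ shrAux w c q
    noLoop u w u≢w true  true  p q _ eq = u≢w (cong proj₁ (just-injective eq))
    noLoop u w u≢w true  false p q _ ()
    noLoop u w u≢w false true  p q _ ()
    noLoop u w u≢w false false p q () _

    shrunk : Graph V' E'
    shrunk = record
      { ends     = λ e → shr (proj₁ (ends G (proj₁ e))) , shr (proj₂ (ends G (proj₁ e)))
      ; loopless = λ e → noLoop _ _ (loopless G (proj₁ e)) _ _ refl refl (proj₂ e)
      }

  shrinkComplement : (X : V → Bool) →
    Graph (Maybe (Σ V λ v → X v ≡ true))
          (Σ E λ e → X (proj₁ (ends G e)) ∨ X (proj₂ (ends G e)) ≡ true)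
  shrinkComplement X = Shrink.shrunk X

-- Every perfect matching N of J lifts to a perfect matching of G: take the perfect
-- matching M₀ of G − V(H) and, on the path of H representing an edge g of J, the edges
-- in even positions if g ∈ N and those in odd positions otherwise. As C is tight, each
-- lift meets C exactly once, and comparing the lifts of suitable perfect matchings of J
-- (J is matching covered of minimum degree three) pins down how C meets H: either H
-- lies in X and M₀ meets C once; or φ(a) is the branch vertex in X̄, every path at a
-- crosses C once, in an even position, and no other path crosses; or no branch vertex
-- lies in X̄ and a single path crosses C twice, in positions of opposite parity. In the
-- last two cases M₀ avoids C. So shrinking X̄ shortens each path by an even number of
-- edges and keeps the paths internally disjoint: the image of H in G/X̄ is a
-- bisubdivision of J, conformal via the restriction of M₀.

module Submission where

open import Defs
open import Axiom.UniquenessOfIdentityProofs using (module Decidable⇒UIP)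
open import Data.Bool using (Bool; true; false; not; _∨_)
open import Data.Bool.Properties using (not-involutive; not-¬; ¬-not) renaming (_≟_ to _≟ᵇ_)
open import Data.Empty using (⊥; ⊥-elim)
open import Data.Fin using (Fin)
import Data.Fin.Properties as Fin
open import Data.List using (List; []; _∷_; length)
open import Data.List.Membership.Propositional using (_∈_; _∉_; find; lose)
import Data.List.Membership.DecPropositional as DecMembership
open import Data.List.Relation.Unary.All as All using (All; []; _∷_)
open import Data.List.Relation.Unary.All.Properties using (¬Any⇒All¬; All¬⇒¬Any)
open import Data.List.Relation.Unary.Any as Any using (here; there)
open import Data.List.Relation.Unary.AllPairs using ([]; _∷_)
open import Data.List.Relation.Unary.Unique.Propositional using (Unique)
open import Data.Maybe using (just; nothing)
open import Data.Maybe.Properties using (just-injective)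
open import Data.Nat using (ℕ; zero; suc; _*_; _+_)
open import Data.Nat.Properties using (+-suc)
open import Data.Product using (Σ; _×_; _,_; proj₁; proj₂)
import Data.Product as Product
open import Data.Sum using (_⊎_; inj₁; inj₂)
import Data.Sum as Sum
open import Data.Unit using (⊤; tt)
open import Function using (_∘_; case_of_; id)
open import Relation.Nullary using (¬_; Dec; yes; no; does; ¬?)
open import Relation.Nullary.Decidable using (dec-true)
open import Relation.Binary.PropositionalEquality
  using (_≡_; _≢_; refl; cong; sym; trans; subst; ≢-sym)

private
  variable
    A : Set
    x y : A
    xs : List A

≡-irrelevantᵇ : {a b : Bool} (p q : a ≡ b) → p ≡ q
≡-irrelevantᵇ = Decidable⇒UIP.≡-irrelevant _≟ᵇ_

does≡true⇒ : {P : Set} (d : Dec P) → does d ≡ true → P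
does≡true⇒ (yes p) _ = p

∨≡true⇒ : ∀ a {b} → a ∨ b ≡ true → a ≡ true ⊎ b ≡ true
∨≡true⇒ true  _ = inj₁ refl
∨≡true⇒ false p = inj₂ p

∨-trueˡ : ∀ {a b} → a ≡ true → a ∨ b ≡ true
∨-trueˡ refl = refl

∨-trueʳ : ∀ {a b} → b ≡ true → a ∨ b ≡ true
∨-trueʳ {true}  _    = refl
∨-trueʳ {false} refl = refl

true⊎false : ∀ b → b ≡ true ⊎ b ≡ false
true⊎false true  = inj₁ refl
true⊎false false = inj₂ refl

isOdd : ℕ → Bool
isOdd zero    = false
isOdd (suc n) = not (isOdd n)

isOdd-double : ∀ k → isOdd (2 * k) ≡ false
isOdd-double zero    = refl
isOdd-double (suc k) rewrite +-suc k (k + 0) = cong (λ b → not (not b)) (isOdd-double k)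

isOdd-1+2k : ∀ k → isOdd (suc (2 * k)) ≡ true
isOdd-1+2k k = cong not (isOdd-double k)

isOdd⇒1+2k : ∀ n → isOdd n ≡ true → Σ ℕ λ k → n ≡ suc (2 * k)
isOdd⇒1+2k (suc zero)    _ = 0 , refl
isOdd⇒1+2k (suc (suc n)) p with isOdd⇒1+2k n (trans (sym (not-involutive (isOdd n))) p)
... | k , refl = suc k , cong (λ m → suc (suc m)) (sym (+-suc k (k + 0)))

oddLength : List A → Bool
oddLength xs = isOdd (length xs)

oddLength-∷ : ∀ (x : A) xs {b} → oddLength (x ∷ xs) ≡ b → oddLength xs ≡ not b
oddLength-∷ _ _ eq = trans (sym (not-involutive _)) (cong not eq)

mutual
  evens : List A → List A
  evens []       = []
  evens (x ∷ xs) = x ∷ odds xs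

  odds : List A → List A
  odds []       = []
  odds (_ ∷ xs) = evens xs

mutual
  evens⊆ : ∀ (xs : List A) → x ∈ evens xs → x ∈ xs
  evens⊆ (_ ∷ _)  (here eq) = here eq
  evens⊆ (_ ∷ ys) (there i) = there (odds⊆ ys i)

  odds⊆ : ∀ (xs : List A) → x ∈ odds xs → x ∈ xs
  odds⊆ (_ ∷ ys) i = there (evens⊆ ys i)

∈⇒∈evens⊎∈odds : ∀ (xs : List A) → x ∈ xs → x ∈ evens xs ⊎ x ∈ odds xs
∈⇒∈evens⊎∈odds (_ ∷ _)  (here eq) = inj₁ (here eq)
∈⇒∈evens⊎∈odds (_ ∷ ys) (there i) = Sum.swap (Sum.map₂ there (∈⇒∈evens⊎∈odds ys i))

∈evens-∷⇒∈odds : ∀ (ys : List A) → x ∈ evens (y ∷ ys) → x ≢ y → x ∈ odds ys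
∈evens-∷⇒∈odds _ (here eq) x≢y = ⊥-elim (x≢y eq)
∈evens-∷⇒∈odds _ (there i) _   = i

alternate : Bool → List A → List A
alternate true  = evens
alternate false = odds

alternate⊆ : ∀ b (xs : List A) → x ∈ alternate b xs → x ∈ xs
alternate⊆ true  = evens⊆
alternate⊆ false = odds⊆

∈⇒∈alternate : ∀ (xs : List A) → x ∈ xs → Σ Bool λ b → x ∈ alternate b xs
∈⇒∈alternate xs i = Sum.[ (true ,_) , (false ,_) ] (∈⇒∈evens⊎∈odds xs i)

OppositeParity : List A → A → A → Set
OppositeParity L x y = (x ∈ evens L × y ∈ odds L) ⊎ (x ∈ odds L × y ∈ evens L)

OppositeParity-sym : ∀ {L : List A} → OppositeParity L x y → OppositeParity L y x
OppositeParity-sym = Sum.swap ∘ Sum.map Product.swap Product.swap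

alternate⇒OppositeParity : ∀ {L : List A} b c → x ∈ alternate b L → y ∈ alternate c L → b ≢ c →
                           OppositeParity L x y
alternate⇒OppositeParity true  true  _  _  b≢c = ⊥-elim (b≢c refl)
alternate⇒OppositeParity true  false kx ky _   = inj₁ (kx , ky)
alternate⇒OppositeParity false true  kx ky _   = inj₂ (kx , ky)
alternate⇒OppositeParity false false _  _  b≢c = ⊥-elim (b≢c refl)

module Walks {V E : Set} (G : Graph V E) where

  private
    variable
      u w z v : V
      e e′ : E

  Joins⇒Incidentˡ : Joins G e u w → Incident G e u
  Joins⇒Incidentˡ (inj₁ refl) = inj₁ refl
  Joins⇒Incidentˡ (inj₂ refl) = inj₂ refl

  Joins⇒Incidentʳ : Joins G e u w → Incident G e w
  Joins⇒Incidentʳ (inj₁ refl) = inj₂ refl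
  Joins⇒Incidentʳ (inj₂ refl) = inj₁ refl

  Joins-Incident⇒≡ : Joins G e u w → Incident G e v → v ≡ u ⊎ v ≡ w
  Joins-Incident⇒≡ (inj₁ refl) (inj₁ p) = inj₁ (sym p)
  Joins-Incident⇒≡ (inj₁ refl) (inj₂ p) = inj₂ (sym p)
  Joins-Incident⇒≡ (inj₂ refl) (inj₁ p) = inj₂ (sym p)
  Joins-Incident⇒≡ (inj₂ refl) (inj₂ p) = inj₁ (sym p)

  Joins⇒¬Incident : Joins G e u w → v ≢ u → v ≢ w → ¬ Incident G e v
  Joins⇒¬Incident j v≢u v≢w i = Sum.[ v≢u , v≢w ] (Joins-Incident⇒≡ j i)

  tailVerts : Walk G u z → List V
  tailVerts []           = []
  tailVerts (step _ _ p) = walkVerts G p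

  start∈walkVerts : (p : Walk G u z) → u ∈ walkVerts G p
  start∈walkVerts []           = here refl
  start∈walkVerts (step _ _ _) = here refl

  end∈walkVerts : (p : Walk G u z) → z ∈ walkVerts G p
  end∈walkVerts []           = here refl
  end∈walkVerts (step _ _ p) = there (end∈walkVerts p)

  incident∈walkVerts : (p : Walk G u z) → e ∈ walkEdges G p → Incident G e v → v ∈ walkVerts G p
  incident∈walkVerts (step _ j p) (here refl) i with Joins-Incident⇒≡ j i
  ... | inj₁ refl = here refl
  ... | inj₂ refl = there (start∈walkVerts p)
  incident∈walkVerts (step _ _ p) (there k) i = there (incident∈walkVerts p k i)

  initVerts⊆walkVerts : (p : Walk G u z) → v ∈ initVerts G p → v ∈ walkVerts G p
  initVerts⊆walkVerts (step _ _ _) (here eq) = here eq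
  initVerts⊆walkVerts (step _ _ p) (there i) = there (initVerts⊆walkVerts p i)

  innerVerts⊆initVerts : (p : Walk G u z) → v ∈ innerVerts G p → v ∈ initVerts G p
  innerVerts⊆initVerts (step _ _ _) = there

  innerVerts⊆walkVerts : (p : Walk G u z) → v ∈ innerVerts G p → v ∈ walkVerts G p
  innerVerts⊆walkVerts p i = initVerts⊆walkVerts p (innerVerts⊆initVerts p i)

  walkVerts⇒start⊎tailVerts : (p : Walk G u z) → v ∈ walkVerts G p → v ≡ u ⊎ v ∈ tailVerts p
  walkVerts⇒start⊎tailVerts []           (here eq) = inj₁ eq
  walkVerts⇒start⊎tailVerts (step _ _ _) (here eq) = inj₁ eq
  walkVerts⇒start⊎tailVerts (step _ _ _) (there i) = inj₂ i

  initVerts⇒start⊎innerVerts : (p : Walk G u z) → v ∈ initVerts G p → v ≡ u ⊎ v ∈ innerVerts G p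
  initVerts⇒start⊎innerVerts (step _ _ _) (here eq) = inj₁ eq
  initVerts⇒start⊎innerVerts (step _ _ _) (there i) = inj₂ i

  walkVerts⇒initVerts⊎end : (p : Walk G u z) → v ∈ walkVerts G p → v ∈ initVerts G p ⊎ v ≡ z
  walkVerts⇒initVerts⊎end []           (here eq) = inj₂ eq
  walkVerts⇒initVerts⊎end (step _ _ _) (here eq) = inj₁ (here eq)
  walkVerts⇒initVerts⊎end (step _ _ p) (there i) = Sum.map₁ there (walkVerts⇒initVerts⊎end p i)

  walkVerts⇒ends⊎innerVerts : (p : Walk G u z) → v ∈ walkVerts G p →
                               v ≡ u ⊎ v ≡ z ⊎ v ∈ innerVerts G p
  walkVerts⇒ends⊎innerVerts []           (here eq) = inj₁ eq
  walkVerts⇒ends⊎innerVerts (step _ _ _) (here eq) = inj₁ eq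
  walkVerts⇒ends⊎innerVerts (step _ _ p) (there i) = inj₂ (Sum.swap (walkVerts⇒initVerts⊎end p i))

  path-start∉tailVerts : (p : Walk G u z) → IsPath G p → u ∉ tailVerts p
  path-start∉tailVerts (step _ _ _) (u∉ ∷ _) = All¬⇒¬Any u∉

  path-start∉innerVerts : (p : Walk G u z) → IsPath G p → u ∉ innerVerts G p
  path-start∉innerVerts (step _ _ p) (u∉ ∷ _) i = All¬⇒¬Any u∉ (initVerts⊆walkVerts p i)

  odd-path-start≢end : (p : Walk G u z) → IsPath G p → oddLength (walkEdges G p) ≡ true → u ≢ z
  odd-path-start≢end (step _ _ p) (u∉ ∷ _) _ refl = All¬⇒¬Any u∉ (end∈walkVerts p)

  path⇒edges-unique : (p : Walk G u z) → IsPath G p → Unique (walkEdges G p)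
  path⇒edges-unique []           _          = []
  path⇒edges-unique (step _ j p) (u∉ ∷ up) =
    ¬Any⇒All¬ _ (λ k → All¬⇒¬Any u∉ (incident∈walkVerts p k (Joins⇒Incidentˡ j)))
    ∷ path⇒edges-unique p up

  CoveredOnce : List E → V → Set
  CoveredOnce L v = Σ E λ e → e ∈ L × Incident G e v × (∀ e′ → e′ ∈ L → Incident G e′ v → e′ ≡ e)

  Uncovered : List E → V → Set
  Uncovered L v = ∀ e → e ∈ L → ¬ Incident G e v

  coveredOnce-here : ∀ {L} → Incident G e v → Uncovered L v → CoveredOnce (e ∷ L) v
  coveredOnce-here i un = _ , here refl , i , λ { _ (here eq) _ → eq ; e′ (there k) i′ → ⊥-elim (un e′ k i′) }

  coveredOnce-there : ∀ {L} → ¬ Incident G e v → CoveredOnce L v → CoveredOnce (e ∷ L) v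
  coveredOnce-there ¬i (e₁ , k , i , un) =
    e₁ , there k , i , λ { _ (here refl) i′ → ⊥-elim (¬i i′) ; e′ (there k′) i′ → un e′ k′ i′ }

  uncovered-∷ : ∀ {L} → ¬ Incident G e v → Uncovered L v → Uncovered (e ∷ L) v
  uncovered-∷ ¬i un _ (here refl) = ¬i
  uncovered-∷ ¬i un e′ (there k)  = un e′ k

  ∉walkVerts⇒uncovered : ∀ {L} (p : Walk G u z) → (∀ {e} → e ∈ L → e ∈ walkEdges G p) →
                          v ∉ walkVerts G p → Uncovered L v
  ∉walkVerts⇒uncovered p L⊆ v∉ e k i = v∉ (incident∈walkVerts p (L⊆ k) i)

  record OddPathMatching (p : Walk G u z) : Set where
    field
      evens-cover      : ∀ v → v ∈ walkVerts G p → CoveredOnce (evens (walkEdges G p)) v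
      odds-cover-inner : ∀ v → v ∈ innerVerts G p → CoveredOnce (odds (walkEdges G p)) v
      odds-avoid-start : Uncovered (odds (walkEdges G p)) u
      odds-avoid-end   : Uncovered (odds (walkEdges G p)) z

  record EvenPathMatching (p : Walk G u z) : Set where
    field
      evens-cover-init : ∀ v → v ∈ initVerts G p → CoveredOnce (evens (walkEdges G p)) v
      evens-avoid-end  : Uncovered (evens (walkEdges G p)) z
      odds-cover-tail  : ∀ v → v ∈ tailVerts p → CoveredOnce (odds (walkEdges G p)) v
      odds-avoid-start : Uncovered (odds (walkEdges G p)) u

  mutual
    oddPathMatching : (p : Walk G u z) → IsPath G p → oddLength (walkEdges G p) ≡ true →
                      OddPathMatching p
    oddPathMatching {u} (step e j p) (u∉ ∷ up) odd = record
      { evens-cover      = cover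
      ; odds-cover-inner = evens-cover-init
      ; odds-avoid-start = ∉walkVerts⇒uncovered p (evens⊆ _) (All¬⇒¬Any u∉)
      ; odds-avoid-end   = evens-avoid-end
      }
      where
      open EvenPathMatching (evenPathMatching p up (oddLength-∷ e (walkEdges G p) odd))
      cover : ∀ v → v ∈ walkVerts G (step e j p) → CoveredOnce (e ∷ odds (walkEdges G p)) v
      cover v (here refl) =
        coveredOnce-here (Joins⇒Incidentˡ j) (∉walkVerts⇒uncovered p (odds⊆ _) (All¬⇒¬Any u∉))
      cover v (there i) with walkVerts⇒start⊎tailVerts p i
      ... | inj₁ refl = coveredOnce-here (Joins⇒Incidentʳ j) odds-avoid-start
      ... | inj₂ t    = coveredOnce-there
        (Joins⇒¬Incident j (λ { refl → All¬⇒¬Any u∉ i }) (λ { refl → path-start∉tailVerts p up t }))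
        (odds-cover-tail v t)

    evenPathMatching : (p : Walk G u z) → IsPath G p → oddLength (walkEdges G p) ≡ false →
                       EvenPathMatching p
    evenPathMatching [] _ _ = record
      { evens-cover-init = λ _ ()
      ; evens-avoid-end  = λ _ ()
      ; odds-cover-tail  = λ _ ()
      ; odds-avoid-start = λ _ ()
      }
    evenPathMatching {u} {z} (step e j p) (u∉ ∷ up) even = record
      { evens-cover-init = cover
      ; evens-avoid-end  = uncovered-∷ (Joins⇒¬Incident j z≢u z≢w) odds-avoid-end
      ; odds-cover-tail  = evens-cover
      ; odds-avoid-start = ∉walkVerts⇒uncovered p (evens⊆ _) (All¬⇒¬Any u∉)
      }
      where
      odd : oddLength (walkEdges G p) ≡ true
      odd = oddLength-∷ e (walkEdges G p) even
      open OddPathMatching (oddPathMatching p up odd)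
      z≢u : z ≢ u
      z≢u refl = All¬⇒¬Any u∉ (end∈walkVerts p)
      z≢w : z ≢ _
      z≢w z≡w = odd-path-start≢end p up odd (sym z≡w)
      cover : ∀ v → v ∈ initVerts G (step e j p) → CoveredOnce (e ∷ odds (walkEdges G p)) v
      cover v (here refl) =
        coveredOnce-here (Joins⇒Incidentˡ j) (∉walkVerts⇒uncovered p (odds⊆ _) (All¬⇒¬Any u∉))
      cover v (there i) with initVerts⇒start⊎innerVerts p i
      ... | inj₁ refl = coveredOnce-here (Joins⇒Incidentʳ j) odds-avoid-start
      ... | inj₂ k    = coveredOnce-there
        (Joins⇒¬Incident j (λ { refl → All¬⇒¬Any u∉ (innerVerts⊆walkVerts p k) })
                           (λ { refl → path-start∉innerVerts p up k }))
        (odds-cover-inner v k)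

module Cuts {V E : Set} (G : Graph V E) (X : V → Bool) where

  private
    variable
      u w z : V
      e c : E

  Joins⇒InCut : Joins G e u w → X u ≢ X w → InCut G X e
  Joins⇒InCut (inj₁ refl) ne = ne
  Joins⇒InCut (inj₂ refl) ne = λ eq → ne (sym eq)

  InCut⇒≢ : Joins G e u w → InCut G X e → X u ≢ X w
  InCut⇒≢ (inj₁ refl) c = c
  InCut⇒≢ (inj₂ refl) c = λ eq → c (sym eq)

  OnSide : Bool → Walk G u z → Set
  OnSide b p = All (λ v → X v ≡ b) (walkVerts G p)

  crossing-edge : (p : Walk G u z) → X u ≢ X z → Σ E λ e → e ∈ walkEdges G p × InCut G X e
  crossing-edge [] ne = ⊥-elim (ne refl)
  crossing-edge {u} (step {w = w} e j p) ne with X u ≟ᵇ X w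
  ... | no  d = e , here refl , Joins⇒InCut j d
  ... | yes d with crossing-edge p (λ eq → ne (trans d eq))
  ...   | c , k , cut = c , there k , cut

  uncrossed⇒OnSide : (p : Walk G u z) → (∀ e → e ∈ walkEdges G p → ¬ InCut G X e) → OnSide (X u) p
  uncrossed⇒OnSide []                   _  = refl ∷ []
  uncrossed⇒OnSide {u} (step {w = w} e j p) nc with X u ≟ᵇ X w
  ... | no  d = ⊥-elim (nc e (here refl) (Joins⇒InCut j d))
  ... | yes d = refl ∷ All.map (λ eq → trans eq (sym d)) (uncrossed⇒OnSide p (λ e′ k → nc e′ (there k)))

  second-crossing : (p : Walk G u z) → X u ≡ X z → Unique (walkEdges G p) →
                    c ∈ walkEdges G p → InCut G X c →
                    Σ E λ c₂ → c₂ ∈ walkEdges G p × InCut G X c₂ × c₂ ≢ c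
  second-crossing (step e j p) eq (e∉ ∷ _) (here refl) cut
    with crossing-edge p (λ d → InCut⇒≢ j cut (trans eq (sym d)))
  ... | c₂ , k , cut₂ = c₂ , there k , cut₂ , λ { refl → All¬⇒¬Any e∉ k }
  second-crossing {u} (step {w = w} e j p) eq (e∉ ∷ up) (there i) cut with X u ≟ᵇ X w
  ... | no  d = e , here refl , Joins⇒InCut j d , λ { refl → All¬⇒¬Any e∉ i }
  ... | yes d with second-crossing p (trans (sym d) eq) up i cut
  ...   | c₂ , k , cut₂ , ne = c₂ , there k , cut₂ , ne

module Contraction {V E : Set} (G : Graph V E) (X : V → Bool) where

  open Walks G
  open Cuts G X
  open Shrink G X
  private
    module Ŵ = Walks shrunk
    variable
      u w z v : V
      e : E

  -- `shr v` is stuck until `X v` is known, hence the generalisation over `X v ≡ b`.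
  shr-true : (t : X v ≡ true) → shr v ≡ just (v , t)
  shr-true {v} t = go (X v) refl
    where
    go : ∀ b (q : X v ≡ b) → shrAux v b q ≡ just (v , t)
    go true  q = cong (λ r → just (v , r)) (≡-irrelevantᵇ q t)
    go false q = ⊥-elim (not-¬ t q)

  shr-false : X v ≡ false → shr v ≡ nothing
  shr-false {v} f = go (X v) refl
    where
    go : ∀ b (q : X v ≡ b) → shrAux v b q ≡ nothing
    go true  q = ⊥-elim (not-¬ q f)
    go false q = refl

  shr≡nothing⇒ : shr v ≡ nothing → X v ≡ false
  shr≡nothing⇒ {v} = go (X v) refl
    where
    go : ∀ b (q : X v ≡ b) → shrAux v b q ≡ nothing → X v ≡ false
    go false q _ = q

  shr≡just⇒ : ∀ {w t} → shr v ≡ just (w , t) → v ≡ w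
  shr≡just⇒ {v} = go (X v) refl
    where
    go : ∀ b (q : X v ≡ b) {w t} → shrAux v b q ≡ just (w , t) → v ≡ w
    go true q eq = cong proj₁ (just-injective eq)

  shr-injective : shr u ≡ shr v → X u ≡ true → u ≡ v
  shr-injective {u} eq t = sym (shr≡just⇒ (trans (sym eq) (shr-true t)))

  Survives : E → Set
  Survives e = X (proj₁ (ends G e)) ∨ X (proj₂ (ends G e)) ≡ true

  Kept : V → V → Set
  Kept u w = X u ≡ true ⊎ X w ≡ true

  kept⊎dropped : ∀ u w → Kept u w ⊎ (X u ≡ false × X w ≡ false)
  kept⊎dropped u w with X u | X w
  ... | true  | _     = inj₁ (inj₁ refl)
  ... | false | true  = inj₁ (inj₂ refl)
  ... | false | false = inj₂ (refl , refl)

  Joins⇒Survives : Joins G e u w → Kept u w → Survives e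
  Joins⇒Survives (inj₁ refl) (inj₁ t) = ∨-trueˡ t
  Joins⇒Survives (inj₁ refl) (inj₂ t) = ∨-trueʳ t
  Joins⇒Survives (inj₂ refl) (inj₁ t) = ∨-trueʳ t
  Joins⇒Survives (inj₂ refl) (inj₂ t) = ∨-trueˡ t

  Joins-shrunk : Joins G e u w → (s : Survives e) → Joins shrunk (e , s) (shr u) (shr w)
  Joins-shrunk (inj₁ refl) s = inj₁ refl
  Joins-shrunk (inj₂ refl) s = inj₂ refl

  shrunkStep : ∀ {x} → Joins G e u w → Survives e → Walk shrunk (shr w) x → Walk shrunk (shr u) x
  shrunkStep {e} j s = step (e , s) (Joins-shrunk j s)

  -- A step with both ends in X̄ would become a loop of G/X̄; it is dropped.
  contractStep : ∀ e → Joins G e u w → Walk shrunk (shr w) (shr z) →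
                 ∀ b → X u ≡ b → ∀ c → X w ≡ c → Walk shrunk (shr u) (shr z)
  contractStep e j r true  qb _    _  = shrunkStep j (Joins⇒Survives j (inj₁ qb)) r
  contractStep e j r false _  true qc = shrunkStep j (Joins⇒Survives j (inj₂ qc)) r
  contractStep {z = z} e j r false qb false qc =
    subst (λ x → Walk shrunk x (shr z)) (trans (shr-false qc) (sym (shr-false qb))) r

  contract : Walk G u z → Walk shrunk (shr u) (shr z)
  contract []                         = []
  contract {u} (step {w = w} e j p) = contractStep e j (contract p) (X u) refl (X w) refl

  contract-kept : (j : Joins G e u w) (p : Walk G w z) (k : Kept u w) →
                  contract (step e j p) ≡ shrunkStep j (Joins⇒Survives j k) (contract p)
  contract-kept {e} {u} {w} j p k = go (X u) refl (X w) refl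
    where
    keep : ∀ s → shrunkStep j s (contract p) ≡ shrunkStep j (Joins⇒Survives j k) (contract p)
    keep s = cong (λ s′ → shrunkStep j s′ (contract p)) (≡-irrelevantᵇ s _)
    go : ∀ b (qb : X u ≡ b) c (qc : X w ≡ c) →
         contractStep e j (contract p) b qb c qc
         ≡ shrunkStep j (Joins⇒Survives j k) (contract p)
    go true  qb _    _  = keep (Joins⇒Survives j (inj₁ qb))
    go false _  true qc = keep (Joins⇒Survives j (inj₂ qc))
    go false qb false qc = ⊥-elim (Sum.[ (λ t → not-¬ t qb) , (λ t → not-¬ t qc) ] k)

  -- Stated for any observation F of walks, since a dropped step changes the start index
  -- of the contracted walk only up to propositional equality.
  contract-dropped : {A : Set} (F : ∀ {a b} → Walk shrunk a b → A) (j : Joins G e u w) (p : Walk G w z) →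
                     X u ≡ false → X w ≡ false → F (contract (step e j p)) ≡ F (contract p)
  contract-dropped {u = u} {w} F j p fu fw = go (X u) refl (X w) refl
    where
    F-subst : ∀ {x y z} (eq : x ≡ y) (r : Walk shrunk x z) → F (subst (λ t → Walk shrunk t z) eq r) ≡ F r
    F-subst refl r = refl
    go : ∀ b (qb : X u ≡ b) c (qc : X w ≡ c) → F (contractStep _ j (contract p) b qb c qc) ≡ F (contract p)
    go true  qb _    _  = ⊥-elim (not-¬ qb fu)
    go false _  true qc = ⊥-elim (not-¬ qc fw)
    go false _  false _ = F-subst _ (contract p)

  oddLength-kept : (j : Joins G e u w) (p : Walk G w z) → Kept u w →
                   oddLength (walkEdges shrunk (contract (step e j p)))
                   ≡ not (oddLength (walkEdges shrunk (contract p)))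
  oddLength-kept j p k = cong (oddLength ∘ walkEdges shrunk) (contract-kept j p k)

  ∈-kept⁺ : {A : Set} {x : A} (F : ∀ {a b} → Walk shrunk a b → List A)
            (j : Joins G e u w) (p : Walk G w z) (k : Kept u w) →
            x ∈ F (shrunkStep j (Joins⇒Survives j k) (contract p)) → x ∈ F (contract (step e j p))
  ∈-kept⁺ F j p k = subst (_ ∈_) (sym (cong F (contract-kept j p k)))

  ∈-kept⁻ : {A : Set} {x : A} (F : ∀ {a b} → Walk shrunk a b → List A)
            (j : Joins G e u w) (p : Walk G w z) (k : Kept u w) →
            x ∈ F (contract (step e j p)) → x ∈ F (shrunkStep j (Joins⇒Survives j k) (contract p))
  ∈-kept⁻ F j p k = subst (_ ∈_) (cong F (contract-kept j p k))

  ∈-dropped⁺ : {A : Set} {x : A} (F : ∀ {a b} → Walk shrunk a b → List A) (j : Joins G e u w) (p : Walk G w z) →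
               X u ≡ false → X w ≡ false → x ∈ F (contract p) → x ∈ F (contract (step e j p))
  ∈-dropped⁺ F j p fu fw = subst (_ ∈_) (sym (contract-dropped F j p fu fw))

  ∈-dropped⁻ : {A : Set} {x : A} (F : ∀ {a b} → Walk shrunk a b → List A) (j : Joins G e u w) (p : Walk G w z) →
               X u ≡ false → X w ≡ false → x ∈ F (contract (step e j p)) → x ∈ F (contract p)
  ∈-dropped⁻ F j p fu fw = subst (_ ∈_) (contract-dropped F j p fu fw)

  dropped⇒¬Survives : Joins G e u w → X u ≡ false → X w ≡ false → ¬ Survives e
  dropped⇒¬Survives (inj₁ refl) fu fw s = Sum.[ (λ t → not-¬ t fu) , (λ t → not-¬ t fw) ] (∨≡true⇒ _ s)
  dropped⇒¬Survives (inj₂ refl) fu fw s = Sum.[ (λ t → not-¬ t fw) , (λ t → not-¬ t fu) ] (∨≡true⇒ _ s)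

  InCut⇒Survives : InCut G X e → Survives e
  InCut⇒Survives {e} c with X (proj₁ (ends G e))
  ... | true  = refl
  ... | false = ¬-not (≢-sym c)

  Survives-X̄⇒InCut : Survives e → X (proj₁ (ends G e)) ≡ false ⊎ X (proj₂ (ends G e)) ≡ false → InCut G X e
  Survives-X̄⇒InCut {e} s f with ∨≡true⇒ (X (proj₁ (ends G e))) s | f
  ... | inj₁ t | inj₁ f₁ = ⊥-elim (not-¬ t f₁)
  ... | inj₁ t | inj₂ f₂ = λ eq → not-¬ t (trans eq f₂)
  ... | inj₂ t | inj₁ f₁ = λ eq → not-¬ t (trans (sym eq) f₁)
  ... | inj₂ t | inj₂ f₂ = ⊥-elim (not-¬ t f₂)

  Survives-irrelevant : ∀ {s s′ : Survives e} → _≡_ {A = E'} (e , s) (e , s′)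
  Survives-irrelevant = cong (_ ,_) (≡-irrelevantᵇ _ _)

  Incident-shrunk : Incident G e v → (t : X v ≡ true) →
                    Σ (Survives e) λ s → Incident shrunk (e , s) (just (v , t))
  Incident-shrunk (inj₁ refl) t = ∨-trueˡ t , inj₁ (shr-true t)
  Incident-shrunk (inj₂ refl) t = ∨-trueʳ t , inj₂ (shr-true t)

  InCut⇒Incident-X̄ : (c : InCut G X e) → Incident shrunk (e , InCut⇒Survives c) nothing
  InCut⇒Incident-X̄ {e} c with true⊎false (X (proj₁ (ends G e)))
  ... | inj₁ X₁ = inj₂ (shr-false (¬-not (λ X₂ → c (trans X₁ (sym X₂)))))
  ... | inj₂ X₁ = inj₁ (shr-false X₁)

  contract-edges⁻ : ∀ {e′} (p : Walk G u z) → e′ ∈ walkEdges shrunk (contract p) → proj₁ e′ ∈ walkEdges G p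
  contract-edges⁻ {u} (step {w = w} e j p) k with kept⊎dropped u w
  ... | inj₁ kept with ∈-kept⁻ (walkEdges shrunk) j p kept k
  ...   | here refl = here refl
  ...   | there k′  = there (contract-edges⁻ p k′)
  contract-edges⁻ {u} (step {w = w} e j p) k | inj₂ (fu , fw) =
    there (contract-edges⁻ p (∈-dropped⁻ (walkEdges shrunk) j p fu fw k))

  contract-edges⁺ : (p : Walk G u z) → e ∈ walkEdges G p → (s : Survives e) →
                    (e , s) ∈ walkEdges shrunk (contract p)
  contract-edges⁺ {u} (step {w = w} e j p) (here refl) s with kept⊎dropped u w
  ... | inj₁ kept = ∈-kept⁺ (walkEdges shrunk) j p kept
                          (here (cong (e ,_) (≡-irrelevantᵇ s _)))
  ... | inj₂ (fu , fw) = ⊥-elim (dropped⇒¬Survives j fu fw s)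
  contract-edges⁺ {u} (step {w = w} e j p) (there i) s with kept⊎dropped u w
  ... | inj₁ kept = ∈-kept⁺ (walkEdges shrunk) j p kept
                          (there (contract-edges⁺ p i s))
  ... | inj₂ (fu , fw) = ∈-dropped⁺ (walkEdges shrunk) j p fu fw
                               (contract-edges⁺ p i s)

  ShrPreimage : List V → V' → Set
  ShrPreimage L x = Σ V λ v → v ∈ L × shr v ≡ x

  shrPreimage-∷ : ∀ {L x} → ShrPreimage L x → ShrPreimage (v ∷ L) x
  shrPreimage-∷ (v , i , eq) = v , there i , eq

  contract-walkVerts⁻ : ∀ {x} (p : Walk G u z) → x ∈ walkVerts shrunk (contract p) →
                        ShrPreimage (walkVerts G p) x
  contract-walkVerts⁻ [] (here eq) = _ , here refl , sym eq
  contract-walkVerts⁻ {u} (step {w = w} e j p) k with kept⊎dropped u w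
  ... | inj₁ kept with ∈-kept⁻ (walkVerts shrunk) j p kept k
  ...   | here eq  = u , here refl , sym eq
  ...   | there k′ = shrPreimage-∷ (contract-walkVerts⁻ p k′)
  contract-walkVerts⁻ {u} (step {w = w} e j p) k | inj₂ (fu , fw) =
    shrPreimage-∷ (contract-walkVerts⁻ p (∈-dropped⁻ (walkVerts shrunk) j p fu fw k))

  contract-initVerts⁻ : ∀ {x} (p : Walk G u z) → x ∈ initVerts shrunk (contract p) →
                        ShrPreimage (initVerts G p) x
  contract-initVerts⁻ {u} (step {w = w} e j p) k with kept⊎dropped u w
  ... | inj₁ kept with ∈-kept⁻ (initVerts shrunk) j p kept k
  ...   | here eq  = u , here refl , sym eq
  ...   | there k′ = shrPreimage-∷ (contract-initVerts⁻ p k′)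
  contract-initVerts⁻ {u} (step {w = w} e j p) k | inj₂ (fu , fw) =
    shrPreimage-∷ (contract-initVerts⁻ p (∈-dropped⁻ (initVerts shrunk) j p fu fw k))

  contract-innerVerts⁻ : ∀ {x} (p : Walk G u z) → x ∈ innerVerts shrunk (contract p) →
                         ShrPreimage (innerVerts G p) x
  contract-innerVerts⁻ {u} (step {w = w} e j p) k with kept⊎dropped u w
  ... | inj₁ kept = contract-initVerts⁻ p (∈-kept⁻ (innerVerts shrunk) j p kept k)
  ... | inj₂ (fu , fw)
    with v , i , eq ← contract-innerVerts⁻ p (∈-dropped⁻ (innerVerts shrunk) j p fu fw k)
    = v , innerVerts⊆initVerts p i , eq

  contract-initVerts⁺ : (p : Walk G u z) → v ∈ initVerts G p → X v ≡ true →
                        shr v ∈ initVerts shrunk (contract p)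
  contract-initVerts⁺ {u} (step {w = w} e j p) (here refl) t with kept⊎dropped u w
  ... | inj₁ kept      = ∈-kept⁺ (initVerts shrunk) j p kept (here refl)
  ... | inj₂ (fu , fw) = ⊥-elim (not-¬ t fu)
  contract-initVerts⁺ {u} (step {w = w} e j p) (there i) t with kept⊎dropped u w
  ... | inj₁ kept      = ∈-kept⁺ (initVerts shrunk) j p kept
                               (there (contract-initVerts⁺ p i t))
  ... | inj₂ (fu , fw) = ∈-dropped⁺ (initVerts shrunk) j p fu fw
                               (contract-initVerts⁺ p i t)

  contract-innerVerts⁺ : (p : Walk G u z) → v ∈ innerVerts G p → X v ≡ true →
                         shr v ∈ innerVerts shrunk (contract p)
  contract-innerVerts⁺ {u} (step {w = w} e j p) i t with kept⊎dropped u w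
  ... | inj₁ kept = ∈-kept⁺ (innerVerts shrunk) j p kept
                          (contract-initVerts⁺ p i t)
  ... | inj₂ (fu , fw) with initVerts⇒start⊎innerVerts p i
  ...   | inj₁ refl = ⊥-elim (not-¬ t fw)
  ...   | inj₂ i′   = ∈-dropped⁺ (innerVerts shrunk) j p fu fw
                            (contract-innerVerts⁺ p i′ t)

  shr∉contract : (p : Walk G u z) → X v ≡ true → v ∉ walkVerts G p → shr v ∉ walkVerts shrunk (contract p)
  shr∉contract p t v∉ k with v′ , i , eq ← contract-walkVerts⁻ p k =
    v∉ (subst (_∈ walkVerts G p) (sym (shr-injective (sym eq) t)) i)

  contract-path-kept : (j : Joins G e u w) (p : Walk G w z) → X u ≡ true → IsPath G (step e j p) →
                       IsPath shrunk (contract p) → IsPath shrunk (contract (step e j p))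
  contract-path-kept j p t (u∉ ∷ _) up =
    subst Unique (sym (cong (walkVerts shrunk) (contract-kept j p (inj₁ t))))
      (¬Any⇒All¬ _ (shr∉contract p t (All¬⇒¬Any u∉)) ∷ up)

  OnSide-start : ∀ {b} (p : Walk G u z) → OnSide b p → X u ≡ b
  OnSide-start p all = All.lookup all (start∈walkVerts p)

  nothing∉contract-X : (p : Walk G u z) → OnSide true p → nothing ∉ walkVerts shrunk (contract p)
  nothing∉contract-X p all k with v , i , eq ← contract-walkVerts⁻ p k =
    not-¬ (All.lookup all i) (shr≡nothing⇒ eq)

  contract-path-X : (p : Walk G u z) → OnSide true p → IsPath G p → IsPath shrunk (contract p)
  contract-path-X []           _         _              = [] ∷ []
  contract-path-X (step e j p) (t ∷ all) up@(_ ∷ up′) = contract-path-kept j p t up (contract-path-X p all up′)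

  contract-oddLength-X : (p : Walk G u z) → OnSide true p →
                         oddLength (walkEdges shrunk (contract p)) ≡ oddLength (walkEdges G p)
  contract-oddLength-X []           _         = refl
  contract-oddLength-X (step e j p) (t ∷ all) =
    trans (oddLength-kept j p (inj₁ t)) (cong not (contract-oddLength-X p all))

  contract-X̄ : {A : Set} (F : ∀ {a b} → Walk shrunk a b → A) (p : Walk G u z) → OnSide false p →
               F (contract p) ≡ F {shr z} []
  contract-X̄ F []           _         = refl
  contract-X̄ F (step e j p) (f ∷ all) =
    trans (contract-dropped F j p f (OnSide-start p all)) (contract-X̄ F p all)

  data Leaves : Walk G u z → E → Set where
    leaves-here  : ∀ {j : Joins G e u w} {p : Walk G w z} → X u ≡ false → OnSide true p → Leaves (step e j p) e
    leaves-there : ∀ {c} {j : Joins G e u w} {p : Walk G w z} → X u ≡ false → Leaves p c → Leaves (step e j p) c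

  data Enters : Walk G u z → E → Set where
    enters-here  : ∀ {j : Joins G e u w} {p : Walk G w z} → X u ≡ true → OnSide false p → Enters (step e j p) e
    enters-there : ∀ {c} {j : Joins G e u w} {p : Walk G w z} → X u ≡ true → Enters p c → Enters (step e j p) c

  data Dips : Walk G u z → E → E → Set where
    dips-here  : ∀ {c} {j : Joins G e u w} {p : Walk G w z} → X u ≡ true → Leaves p c → Dips (step e j p) e c
    dips-there : ∀ {c₁ c₂} {j : Joins G e u w} {p : Walk G w z} → X u ≡ true → Dips p c₁ c₂ →
                 Dips (step e j p) c₁ c₂

  private
    variable
      c c₁ c₂ : E

  leaves-start : {p : Walk G u z} → Leaves p c → X u ≡ false
  leaves-start (leaves-here f _)  = f
  leaves-start (leaves-there f _) = f

  leaves-edge : {p : Walk G u z} → Leaves p c → c ∈ walkEdges G p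
  leaves-edge (leaves-here _ _)  = here refl
  leaves-edge (leaves-there _ l) = there (leaves-edge l)

  enters-edge : {p : Walk G u z} → Enters p c → c ∈ walkEdges G p
  enters-edge (enters-here _ _)  = here refl
  enters-edge (enters-there _ l) = there (enters-edge l)

  dips-edge₁ : {p : Walk G u z} → Dips p c₁ c₂ → c₁ ∈ walkEdges G p
  dips-edge₁ (dips-here _ _)  = here refl
  dips-edge₁ (dips-there _ d) = there (dips-edge₁ d)

  dips-edge₂ : {p : Walk G u z} → Dips p c₁ c₂ → c₂ ∈ walkEdges G p
  dips-edge₂ (dips-here _ l)  = there (leaves-edge l)
  dips-edge₂ (dips-there _ d) = there (dips-edge₂ d)

  leaves-path : {p : Walk G u z} → Leaves p c → IsPath G p → IsPath shrunk (contract p)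
  leaves-path (leaves-here {j = j} {p = p} f all) (_ ∷ up) =
    subst Unique (sym (cong (walkVerts shrunk) (contract-kept j p (inj₂ (OnSide-start p all)))))
      (¬Any⇒All¬ _ (λ k → nothing∉contract-X p all (subst (_∈ walkVerts shrunk (contract p)) (shr-false f) k))
       ∷ contract-path-X p all up)
  leaves-path (leaves-there {j = j} {p = p} f l) (_ ∷ up) =
    subst Unique (sym (contract-dropped (walkVerts shrunk) j p f (leaves-start l))) (leaves-path l up)

  leaves-oddLength : {p : Walk G u z} → Leaves p c → Unique (walkEdges G p) →
    (c ∈ evens (walkEdges G p) → oddLength (walkEdges shrunk (contract p)) ≡ oddLength (walkEdges G p)) ×
    (c ∈ odds (walkEdges G p) → oddLength (walkEdges shrunk (contract p)) ≡ not (oddLength (walkEdges G p)))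
  leaves-oddLength (leaves-here {j = j} {p = p} f all) (e∉ ∷ _) =
    (λ _ → trans (oddLength-kept j p (inj₂ (OnSide-start p all)))
                 (cong not (contract-oddLength-X p all))) ,
    (λ k → ⊥-elim (All¬⇒¬Any e∉ (evens⊆ _ k)))
  leaves-oddLength (leaves-there {e = e} {j = j} {p = p} f l) (e∉ ∷ ue) =
    (λ k → trans dropped (odd (∈evens-∷⇒∈odds (walkEdges G p) k
                                 (λ { refl → All¬⇒¬Any e∉ (leaves-edge l) })))) ,
    (λ k → trans dropped (trans (even k) (sym (not-involutive _))))
    where
    dropped = contract-dropped (oddLength ∘ walkEdges shrunk) j p f (leaves-start l)
    even = proj₁ (leaves-oddLength l ue)
    odd  = proj₂ (leaves-oddLength l ue)

  leaves-nothing∈initVerts : {p : Walk G u z} → Leaves p c → nothing ∈ initVerts shrunk (contract p)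
  leaves-nothing∈initVerts (leaves-here {j = j} {p = p} f all) =
    ∈-kept⁺ (initVerts shrunk) j p (inj₂ (OnSide-start p all))
      (here (sym (shr-false f)))
  leaves-nothing∈initVerts (leaves-there {j = j} {p = p} f l) =
    ∈-dropped⁺ (initVerts shrunk) j p f (leaves-start l) (leaves-nothing∈initVerts l)

  leaves-nothing∉innerVerts : {p : Walk G u z} → Leaves p c → nothing ∉ innerVerts shrunk (contract p)
  leaves-nothing∉innerVerts (leaves-here {j = j} {p = p} f all) k =
    nothing∉contract-X p all (Ŵ.initVerts⊆walkVerts (contract p)
      (∈-kept⁻ (innerVerts shrunk) j p (inj₂ (OnSide-start p all)) k))
  leaves-nothing∉innerVerts (leaves-there {j = j} {p = p} f l) k =
    leaves-nothing∉innerVerts l (∈-dropped⁻ (innerVerts shrunk) j p f (leaves-start l) k)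

  enters-path : {p : Walk G u z} → Enters p c → IsPath G p → IsPath shrunk (contract p)
  enters-path (enters-here {j = j} {p = p} t all) up =
    contract-path-kept j p t up (subst Unique (sym (contract-X̄ (walkVerts shrunk) p all)) ([] ∷ []))
  enters-path (enters-there {j = j} {p = p} t l) up@(_ ∷ up′) = contract-path-kept j p t up (enters-path l up′)

  enters-oddLength : {p : Walk G u z} → Enters p c → Unique (walkEdges G p) →
    (c ∈ evens (walkEdges G p) → oddLength (walkEdges shrunk (contract p)) ≡ true) ×
    (c ∈ odds (walkEdges G p) → oddLength (walkEdges shrunk (contract p)) ≡ false)
  enters-oddLength (enters-here {j = j} {p = p} t all) (e∉ ∷ _) =
    (λ _ → trans (oddLength-kept j p (inj₁ t))
                 (cong (not ∘ oddLength) (contract-X̄ (walkEdges shrunk) p all))) ,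
    (λ k → ⊥-elim (All¬⇒¬Any e∉ (evens⊆ _ k)))
  enters-oddLength (enters-there {j = j} {p = p} t l) (e∉ ∷ ue) =
    (λ k → trans kept (cong not (odd (∈evens-∷⇒∈odds (walkEdges G p) k
                                        (λ { refl → All¬⇒¬Any e∉ (enters-edge l) }))))) ,
    (λ k → trans kept (cong not (even k)))
    where
    kept = oddLength-kept j p (inj₁ t)
    even = proj₁ (enters-oddLength l ue)
    odd  = proj₂ (enters-oddLength l ue)

  enters-nothing∉initVerts : {p : Walk G u z} → Enters p c → nothing ∉ initVerts shrunk (contract p)
  enters-nothing∉initVerts (enters-here {j = j} {p = p} t all) k
    with ∈-kept⁻ (initVerts shrunk) j p (inj₁ t) k
  ... | here eq  = case trans (sym (shr-true t)) (sym eq) of λ ()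
  ... | there k′ = case subst (nothing ∈_) (contract-X̄ (initVerts shrunk) p all) k′ of λ ()
  enters-nothing∉initVerts (enters-there {j = j} {p = p} t l) k
    with ∈-kept⁻ (initVerts shrunk) j p (inj₁ t) k
  ... | here eq  = case trans (sym (shr-true t)) (sym eq) of λ ()
  ... | there k′ = enters-nothing∉initVerts l k′

  enters-nothing∉innerVerts : {p : Walk G u z} → Enters p c → nothing ∉ innerVerts shrunk (contract p)
  enters-nothing∉innerVerts (enters-here {j = j} {p = p} t all) k
    with () ← subst (nothing ∈_) (trans (cong (innerVerts shrunk) (contract-kept j p (inj₁ t)))
                                        (contract-X̄ (initVerts shrunk) p all)) k
  enters-nothing∉innerVerts (enters-there {j = j} {p = p} t l) k =
    enters-nothing∉initVerts l (∈-kept⁻ (innerVerts shrunk) j p (inj₁ t) k)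

  dips-path : {p : Walk G u z} → Dips p c₁ c₂ → IsPath G p → IsPath shrunk (contract p)
  dips-path (dips-here  {j = j} {p = p} t l) up@(_ ∷ up′) = contract-path-kept j p t up (leaves-path l up′)
  dips-path (dips-there {j = j} {p = p} t d) up@(_ ∷ up′) = contract-path-kept j p t up (dips-path d up′)

  dips-oddLength : {p : Walk G u z} → Dips p c₁ c₂ → Unique (walkEdges G p) →
                   OppositeParity (walkEdges G p) c₁ c₂ →
                   oddLength (walkEdges shrunk (contract p)) ≡ oddLength (walkEdges G p)
  dips-oddLength (dips-here {j = j} {p = p} t l) (e∉ ∷ ue) (inj₁ (_ , k₂)) =
    trans (oddLength-kept j p (inj₁ t))
          (cong not (proj₁ (leaves-oddLength l ue) k₂))
  dips-oddLength (dips-here t l) (e∉ ∷ _) (inj₂ (k₁ , _)) = ⊥-elim (All¬⇒¬Any e∉ (evens⊆ _ k₁))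
  dips-oddLength (dips-there {c₁ = c₁} {c₂} {j = j} {p = p} t d) (e∉ ∷ ue) par =
    trans (oddLength-kept j p (inj₁ t))
          (cong not (dips-oddLength d ue (shift par)))
    where
    ∉head : ∀ {c} → c ∈ walkEdges G p → c ≢ _
    ∉head k refl = All¬⇒¬Any e∉ k
    shift : OppositeParity (walkEdges G (step _ j p)) c₁ c₂ → OppositeParity (walkEdges G p) c₁ c₂
    shift (inj₁ (k₁ , k₂)) = inj₂ (∈evens-∷⇒∈odds (walkEdges G p) k₁ (∉head (dips-edge₁ d)) , k₂)
    shift (inj₂ (k₁ , k₂)) = inj₁ (k₁ , ∈evens-∷⇒∈odds (walkEdges G p) k₂ (∉head (dips-edge₂ d)))

  dips-nothing∈initVerts : {p : Walk G u z} → Dips p c₁ c₂ → nothing ∈ initVerts shrunk (contract p)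
  dips-nothing∈initVerts (dips-here {j = j} {p = p} t l) =
    ∈-kept⁺ (initVerts shrunk) j p (inj₁ t) (there (leaves-nothing∈initVerts l))
  dips-nothing∈initVerts (dips-there {j = j} {p = p} t d) =
    ∈-kept⁺ (initVerts shrunk) j p (inj₁ t) (there (dips-nothing∈initVerts d))

  dips-nothing∈innerVerts : {p : Walk G u z} → Dips p c₁ c₂ → nothing ∈ innerVerts shrunk (contract p)
  dips-nothing∈innerVerts (dips-here {j = j} {p = p} t l) =
    ∈-kept⁺ (innerVerts shrunk) j p (inj₁ t) (leaves-nothing∈initVerts l)
  dips-nothing∈innerVerts (dips-there {j = j} {p = p} t d) =
    ∈-kept⁺ (innerVerts shrunk) j p (inj₁ t) (dips-nothing∈initVerts d)

  private
    OnlyCrossing : Walk G u z → E → Set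
    OnlyCrossing p c = ∀ e → e ∈ walkEdges G p → InCut G X e → e ≡ c

    after-only-crossing : ∀ {j : Joins G e u w} (p : Walk G w z) → e ∉ walkEdges G p →
                          OnlyCrossing (step e j p) e → ∀ e′ → e′ ∈ walkEdges G p → ¬ InCut G X e′
    after-only-crossing p e∉ only e′ k cut = e∉ (subst (_∈ walkEdges G p) (only e′ (there k) cut) k)

  leaves-intro : (p : Walk G u z) → X u ≡ false → X z ≡ true → Unique (walkEdges G p) →
                 OnlyCrossing p c → Leaves p c
  leaves-intro [] f t _ _ = ⊥-elim (not-¬ t f)
  leaves-intro (step {w = w} e j p) f t (e∉ ∷ ue) only with X w ≟ᵇ true
  ... | no nw = leaves-there f (leaves-intro p (¬-not nw) t ue (λ e′ k → only e′ (there k)))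
  ... | yes tw with refl ← only e (here refl) (Joins⇒InCut j (λ d → not-¬ tw (trans (sym d) f))) =
    leaves-here f (All.map (λ eq → trans eq tw)
                           (uncrossed⇒OnSide p (after-only-crossing {j = j} p (All¬⇒¬Any e∉) only)))

  enters-intro : (p : Walk G u z) → X u ≡ true → X z ≡ false → Unique (walkEdges G p) →
                 OnlyCrossing p c → Enters p c
  enters-intro [] t f _ _ = ⊥-elim (not-¬ t f)
  enters-intro (step {w = w} e j p) t f (e∉ ∷ ue) only with X w ≟ᵇ false
  ... | no nw = enters-there t (enters-intro p (¬-not nw) f ue (λ e′ k → only e′ (there k)))
  ... | yes fw with refl ← only e (here refl) (Joins⇒InCut j (λ d → not-¬ t (trans d fw))) =
    enters-here t (All.map (λ eq → trans eq fw)
                           (uncrossed⇒OnSide p (after-only-crossing {j = j} p (All¬⇒¬Any e∉) only)))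

  dips-intro : (p : Walk G u z) → X u ≡ true → X z ≡ true → Unique (walkEdges G p) →
               c₁ ∈ walkEdges G p → InCut G X c₁ →
               (∀ e → e ∈ walkEdges G p → InCut G X e → e ≡ c₁ ⊎ e ≡ c₂) →
               Dips p c₁ c₂ ⊎ Dips p c₂ c₁
  dips-intro (step {w = w} e j p) t tz (e∉ ∷ ue) k₁ cut₁ only with X w ≟ᵇ true
  ... | yes tw = Sum.map (dips-there t) (dips-there t)
                         (dips-intro p tw tz ue (k₁′ k₁ cut₁) cut₁ (λ e′ k → only e′ (there k)))
    where
    k₁′ : ∀ {c} → c ∈ walkEdges G (step e j p) → InCut G X c → c ∈ walkEdges G p
    k₁′ (here refl) cut = ⊥-elim (InCut⇒≢ j cut (trans t (sym tw)))
    k₁′ (there k)   _   = k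
  ... | no nw with only e (here refl) (Joins⇒InCut j (λ d → nw (trans (sym d) t)))
  ...   | inj₁ refl = inj₁ (dips-here t (leaves-intro p (¬-not nw) tz ue λ e′ k cut →
                        Sum.[ (λ { refl → ⊥-elim (All¬⇒¬Any e∉ k) }) , id ] (only e′ (there k) cut)))
  ...   | inj₂ refl = inj₂ (dips-here t (leaves-intro p (¬-not nw) tz ue λ e′ k cut →
                        Sum.[ id , (λ { refl → ⊥-elim (All¬⇒¬Any e∉ k) }) ] (only e′ (there k) cut)))

module PerfectMatchings {V E : Set} (G : Graph V E) where

  matched-edge-excludes : ∀ {N g h a} → IsPerfectMatching G N → Incident G g a → Incident G h a →
                          g ≢ h → N h ≡ true → N g ≡ false
  matched-edge-excludes {N} {g} {h} {a} pm ig ih g≢h Nh with N g in Ng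
  ... | false = refl
  ... | true  with _ , _ , unique ← pm a = ⊥-elim (g≢h (trans (unique g (Ng , ig)) (sym (unique h (Nh , ih)))))

module MatchingCoveredMinDegree3
  {n m : ℕ} (J : Graph (Fin n) (Fin m)) (mc : MatchingCovered J) (δ : MinDegree≥3 J) where

  open PerfectMatchings J

  perfectMatching-with : ∀ g b → Σ (Fin m → Bool) λ N → IsPerfectMatching J N × N g ≡ b
  perfectMatching-with g true = proj₂ (proj₂ mc) g
  perfectMatching-with g false
    with e₁ , e₂ , _ , e₁≢e₂ , _ , _ , (_ , i₁) , (_ , i₂) , _ ← δ (proj₁ (ends J g)) | e₁ Fin.≟ g
  ... | yes refl with N , pm , Ne₂ ← proj₂ (proj₂ mc) e₂ =
    N , pm , matched-edge-excludes pm (inj₁ refl) i₂ e₁≢e₂ Ne₂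
  ... | no  e₁≢g with N , pm , Ne₁ ← proj₂ (proj₂ mc) e₁ =
    N , pm , matched-edge-excludes pm (inj₁ refl) i₁ (λ eq → e₁≢g (sym eq)) Ne₁

  somePerfectMatching : Σ (Fin m → Bool) (IsPerfectMatching J)
  somePerfectMatching with u , _ ← proj₁ mc with N , pm , _ ← perfectMatching-with (proj₁ (δ u)) true = N , pm

  two-other-edges : ∀ a g → Σ (Fin m) λ h → Σ (Fin m) λ h′ →
                    Incident J h a × Incident J h′ a × h ≢ g × h′ ≢ g × h ≢ h′
  two-other-edges a g with e₁ , e₂ , e₃ , e₁≢e₂ , e₁≢e₃ , e₂≢e₃ , (_ , i₁) , (_ , i₂) , (_ , i₃) ← δ a
                         | g Fin.≟ e₁ | g Fin.≟ e₂
  ... | yes refl | _        = e₂ , e₃ , i₂ , i₃ , ≢-sym e₁≢e₂ , ≢-sym e₁≢e₃ , e₂≢e₃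
  ... | no g≢e₁  | yes refl = e₁ , e₃ , i₁ , i₃ , ≢-sym g≢e₁ , ≢-sym e₂≢e₃ , e₁≢e₃
  ... | no g≢e₁  | no g≢e₂  = e₁ , e₂ , i₁ , i₂ , ≢-sym g≢e₁ , ≢-sym g≢e₂ , e₁≢e₂

module ConformalBisubdivision
  {nJ mJ : ℕ} {J : Graph (Fin nJ) (Fin mJ)}
  {n m : ℕ} {G : Graph (Fin n) (Fin m)} {H : Subgraph G}
  (conf : Conformal G H) (bd : IsBisubdivisionOf G H J) where

  open BisubdivisionData bd public
  open Walks G
  open OddPathMatching
  open DecMembership (Fin._≟_ {m}) using (_∈?_)

  private
    variable
      a : Fin nJ
      f g : Fin mJ
      e : Fin m
      v : Fin n
      b : Bool

  pathEdges : Fin mJ → List (Fin m)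
  pathEdges f = walkEdges G (path f)

  M₀ : Fin m → Bool
  M₀ = proj₁ conf

  M₀-avoids-H : M₀ e ≡ true → Incident G e v → ¬ VH H v
  M₀-avoids-H {e} M₀e (inj₁ refl) = proj₁ (proj₁ (proj₂ conf) e M₀e)
  M₀-avoids-H {e} M₀e (inj₂ refl) = proj₂ (proj₁ (proj₂ conf) e M₀e)

  M₀-perfect-off-H : ¬ VH H v → ExactlyOne G (λ e → (M₀ e ≡ true) × Incident G e v)
  M₀-perfect-off-H = proj₂ (proj₂ conf) _

  path⊆H : v ∈ walkVerts G (path f) → VH H v
  path⊆H {f = f} i with walkVerts⇒ends⊎innerVerts (path f) i
  ... | inj₁ refl        = vertices-image _
  ... | inj₂ (inj₁ refl) = vertices-image _
  ... | inj₂ (inj₂ k)    = vertices-inner f _ k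

  path-edge⇒¬M₀ : e ∈ pathEdges f → M₀ e ≢ true
  path-edge⇒¬M₀ {f = f} k M₀e = M₀-avoids-H M₀e (inj₁ refl) (path⊆H (incident∈walkVerts (path f) k (inj₁ refl)))

  path-oddLength : ∀ f → oddLength (pathEdges f) ≡ true
  path-oddLength f with k , eq ← odd f rewrite eq = isOdd-1+2k k

  path-edges-unique : ∀ f → Unique (pathEdges f)
  path-edges-unique f = path⇒edges-unique (path f) (isPath f)

  pathMatching : ∀ f → OddPathMatching (path f)
  pathMatching f = oddPathMatching (path f) (isPath f) (path-oddLength f)

  Incident⇒φ∈path : Incident J g a → φ a ∈ walkVerts G (path g)
  Incident⇒φ∈path {g} (inj₁ refl) = start∈walkVerts (path g)
  Incident⇒φ∈path {g} (inj₂ refl) = end∈walkVerts (path g)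

  φ∈path⇒Incident : φ a ∈ walkVerts G (path g) → Incident J g a
  φ∈path⇒Incident {g = g} i with walkVerts⇒ends⊎innerVerts (path g) i
  ... | inj₁ eq        = inj₁ (sym (φ-inj _ _ eq))
  ... | inj₂ (inj₁ eq) = inj₂ (sym (φ-inj _ _ eq))
  ... | inj₂ (inj₂ k)  = ⊥-elim (inner-not-branch g _ k)

  path-edges-disjoint : f ≢ g → ∀ {e e′} → e ∈ pathEdges f → e′ ∈ pathEdges g → e ≢ e′
  path-edges-disjoint f≢g k k′ refl = edge-disjoint _ _ _ f≢g k k′

  innerVerts⇒unique-path : v ∈ innerVerts G (path f) → v ∈ walkVerts G (path g) → g ≡ f
  innerVerts⇒unique-path {f = f} {g = g} i k with walkVerts⇒ends⊎innerVerts (path g) k | g Fin.≟ f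
  ... | inj₁ refl        | _       = ⊥-elim (inner-not-branch f _ i)
  ... | inj₂ (inj₁ refl) | _       = ⊥-elim (inner-not-branch f _ i)
  ... | inj₂ (inj₂ _)    | yes g≡f = g≡f
  ... | inj₂ (inj₂ k′)   | no g≢f  = ⊥-elim (inner-disjoint f g _ (≢-sym g≢f) i k′)

  alternate-covers-inner : ∀ f b → v ∈ innerVerts G (path f) → CoveredOnce (alternate b (pathEdges f)) v
  alternate-covers-inner f true  i = evens-cover (pathMatching f) _ (innerVerts⊆walkVerts (path f) i)
  alternate-covers-inner f false i = odds-cover-inner (pathMatching f) _ i

  liftMatching : (Fin mJ → Bool) → Fin m → Bool
  liftMatching N e = M₀ e ∨ does (Fin.any? λ g → e ∈? alternate (N g) (pathEdges g))

  module _ {N : Fin mJ → Bool} where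

    liftMatching-M₀ : M₀ e ≡ true → liftMatching N e ≡ true
    liftMatching-M₀ = ∨-trueˡ

    liftMatching-path : N g ≡ b → e ∈ alternate b (pathEdges g) → liftMatching N e ≡ true
    liftMatching-path {g} refl k = ∨-trueʳ (dec-true (Fin.any? _) (g , k))

    liftMatching⇒ : liftMatching N e ≡ true → M₀ e ≡ true ⊎ Σ (Fin mJ) λ g → e ∈ alternate (N g) (pathEdges g)
    liftMatching⇒ {e} l = Sum.map₂ (does≡true⇒ (Fin.any? _)) (∨≡true⇒ (M₀ e) l)

    module _ (pm : IsPerfectMatching J N) where

      liftMatching-perfect-off-H : ¬ VH H v → ExactlyOne G (λ e → (liftMatching N e ≡ true) × Incident G e v)
      liftMatching-perfect-off-H v∉H with e , (M₀e , i) , unique ← M₀-perfect-off-H v∉H =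
        e , (liftMatching-M₀ M₀e , i) , unique′
        where
        unique′ : ∀ e′ → (liftMatching N e′ ≡ true) × Incident G e′ _ → e′ ≡ e
        unique′ e′ (l , i′) with liftMatching⇒ l
        ... | inj₁ M₀e′      = unique e′ (M₀e′ , i′)
        ... | inj₂ (g , k)   = ⊥-elim (v∉H (path⊆H (incident∈walkVerts (path g) (alternate⊆ (N g) _ k) i′)))

      liftMatching-perfect-φ : ∀ a → ExactlyOne G (λ e → (liftMatching N e ≡ true) × Incident G e (φ a))
      liftMatching-perfect-φ a
        with g , (Ng , ig) , uniqueᴶ ← pm a
        with e , k , i , unique ← evens-cover (pathMatching g) (φ a) (Incident⇒φ∈path ig) =
        e , (liftMatching-path Ng k , i) , unique′
        where
        on-path : ∀ e′ g′ b → N g′ ≡ b → e′ ∈ alternate b (pathEdges g′) → Incident G e′ (φ a) → e′ ≡ e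
        on-path e′ g′ true  Ng′ k′ i′
          with refl ← uniqueᴶ g′ (Ng′ , φ∈path⇒Incident (incident∈walkVerts (path g′) (evens⊆ _ k′) i′)) =
          unique e′ k′ i′
        on-path e′ g′ false _ k′ i′ with φ∈path⇒Incident (incident∈walkVerts (path g′) (odds⊆ _ k′) i′)
        ... | inj₁ refl = ⊥-elim (odds-avoid-start (pathMatching g′) e′ k′ i′)
        ... | inj₂ refl = ⊥-elim (odds-avoid-end (pathMatching g′) e′ k′ i′)
        unique′ : ∀ e′ → (liftMatching N e′ ≡ true) × Incident G e′ (φ a) → e′ ≡ e
        unique′ e′ (l , i′) with liftMatching⇒ l
        ... | inj₁ M₀e′    = ⊥-elim (M₀-avoids-H M₀e′ i′ (vertices-image a))
        ... | inj₂ (g′ , k′) = on-path e′ g′ (N g′) refl k′ i′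

      liftMatching-perfect-inner : ∀ f → v ∈ innerVerts G (path f) →
                                   ExactlyOne G (λ e → (liftMatching N e ≡ true) × Incident G e v)
      liftMatching-perfect-inner {v} f i with e , k , i₁ , unique ← alternate-covers-inner f (N f) i =
        e , (liftMatching-path refl k , i₁) , unique′
        where
        unique′ : ∀ e′ → (liftMatching N e′ ≡ true) × Incident G e′ v → e′ ≡ e
        unique′ e′ (l , i′) with liftMatching⇒ l
        ... | inj₁ M₀e′ = ⊥-elim (M₀-avoids-H M₀e′ i′ (vertices-inner f v i))
        ... | inj₂ (g , k′)
          with refl ← innerVerts⇒unique-path i (incident∈walkVerts (path g) (alternate⊆ (N g) _ k′) i′) =
          unique e′ k′ i′

      liftMatching-perfect : IsPerfectMatching G (liftMatching N)
      liftMatching-perfect v with Fin.any? (λ a → φ a Fin.≟ v)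
      ... | yes (a , refl) = liftMatching-perfect-φ a
      ... | no  v∉φ with Fin.any? (λ f → Any.any? (v Fin.≟_) (innerVerts G (path f)))
      ...   | yes (f , i) = liftMatching-perfect-inner f i
      ...   | no  v∉inner = liftMatching-perfect-off-H λ v∈H →
                              Sum.[ v∉φ , v∉inner ] (vertices v v∈H)

  φ-branch : MinDegree≥3 J → ∀ a → Branch G H (φ a)
  φ-branch δ a
    with f₁ , f₂ , f₃ , f₁≢f₂ , f₁≢f₃ , f₂≢f₃ , (_ , i₁) , (_ , i₂) , (_ , i₃) ← δ a
    with e₁ , k₁ , c₁ , _ ← evens-cover (pathMatching f₁) (φ a) (Incident⇒φ∈path i₁)
       | e₂ , k₂ , c₂ , _ ← evens-cover (pathMatching f₂) (φ a) (Incident⇒φ∈path i₂)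
       | e₃ , k₃ , c₃ , _ ← evens-cover (pathMatching f₃) (φ a) (Incident⇒φ∈path i₃) =
    vertices-image a , e₁ , e₂ , e₃ ,
    path-edges-disjoint f₁≢f₂ (evens⊆ _ k₁) (evens⊆ _ k₂) ,
    path-edges-disjoint f₁≢f₃ (evens⊆ _ k₁) (evens⊆ _ k₃) ,
    path-edges-disjoint f₂≢f₃ (evens⊆ _ k₂) (evens⊆ _ k₃) ,
    (edges-image f₁ e₁ (evens⊆ _ k₁) , c₁) ,
    (edges-image f₂ e₂ (evens⊆ _ k₂) , c₂) ,
    (edges-image f₃ e₃ (evens⊆ _ k₃) , c₃)

module ShrinkingTightCut
  {nJ mJ : ℕ} {J : Graph (Fin nJ) (Fin mJ)} (mcJ : MatchingCovered J) (δJ : MinDegree≥3 J)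
  {n m : ℕ} {G : Graph (Fin n) (Fin m)} {H : Subgraph G}
  (conf : Conformal G H) (bd : IsBisubdivisionOf G H J)
  (X : Fin n → Bool) (tight : TightCut G X)
  (X̄-branch-unique : ∀ u v → Branch G H u → Branch G H v → X u ≡ false → X v ≡ false → u ≡ v)
  where

  open ConformalBisubdivision conf bd
  open MatchingCoveredMinDegree3 J mcJ δJ
  open PerfectMatchings J
  open Walks G
  open Cuts G X
  open Contraction G X
  open Shrink G X using (V'; E'; shr; shrunk)
  private
    module Ŵ = Walks shrunk
    variable
      a : Fin nJ
      f g : Fin mJ
      e e₁ e₂ : Fin m
      v : Fin n
      N : Fin mJ → Bool

  lift-crossing-unique : IsPerfectMatching J N → liftMatching N e₁ ≡ true → InCut G X e₁ →
                         liftMatching N e₂ ≡ true → InCut G X e₂ → e₁ ≡ e₂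
  lift-crossing-unique pm l₁ c₁ l₂ c₂ with _ , _ , unique ← tight _ (liftMatching-perfect pm) =
    trans (unique _ (l₁ , c₁)) (sym (unique _ (l₂ , c₂)))

  φ-X̄-unique : ∀ a b → X (φ a) ≡ false → X (φ b) ≡ false → a ≡ b
  φ-X̄-unique a b fa fb = φ-inj a b (X̄-branch-unique _ _ (φ-branch δJ a) (φ-branch δJ b) fa fb)

  -- What each case supplies; X̄∈H′ says whether the vertex X̄ of G/X̄ is to lie in the
  -- image H′ of H.
  record ContractionFacts : Set₁ where
    field
      X̄∈H′          : Set
      H-meets-X̄     : VH H v → X v ≡ false → X̄∈H′
      M₀-uncut       : X̄∈H′ → M₀ e ≡ true → ¬ InCut G X e
      M₀-cut-once    : ¬ X̄∈H′ → ExactlyOne G (λ e → (M₀ e ≡ true) × InCut G X e)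
      contract-path  : ∀ f → IsPath shrunk (contract (path f))
      contract-odd   : ∀ f → oddLength (walkEdges shrunk (contract (path f))) ≡ true
      X̄-image⊎inner  : X̄∈H′ → (Σ (Fin nJ) λ a → X (φ a) ≡ false) ⊎
                                (Σ (Fin mJ) λ f → nothing ∈ innerVerts shrunk (contract (path f)))
      X̄-inner⇒∈H′   : ∀ f → nothing ∈ innerVerts shrunk (contract (path f)) → X̄∈H′
      X̄-image⇒¬inner : ∀ f a → X (φ a) ≡ false → nothing ∉ innerVerts shrunk (contract (path f))
      X̄-inner-unique : ∀ f g → f ≢ g → nothing ∈ innerVerts shrunk (contract (path f)) →
                        nothing ∉ innerVerts shrunk (contract (path g))

  module _ (facts : ContractionFacts) where

    open ContractionFacts facts

    VH′ : V' → Set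
    VH′ (just (v , _)) = VH H v
    VH′ nothing        = X̄∈H′

    VH⇒VH′ : VH H v → VH′ (shr v)
    VH⇒VH′ {v} h with true⊎false (X v)
    ... | inj₁ Xv = subst VH′ (sym (shr-true Xv)) h
    ... | inj₂ Xv = subst VH′ (sym (shr-false Xv)) (H-meets-X̄ h Xv)

    ¬VH⇒¬VH′ : ¬ VH H v → (X v ≡ false → ¬ X̄∈H′) → ¬ VH′ (shr v)
    ¬VH⇒¬VH′ {v} v∉H X̄∉H′ h with true⊎false (X v)
    ... | inj₁ Xv = v∉H (subst VH′ (shr-true Xv) h)
    ... | inj₂ Xv = X̄∉H′ Xv (subst VH′ (shr-false Xv) h)

    H′ : Subgraph shrunk
    H′ = record
      { VH     = VH′
      ; EH     = EH H ∘ proj₁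
      ; closed = λ e h → VH⇒VH′ (proj₁ (closed H (proj₁ e) h)) , VH⇒VH′ (proj₂ (closed H (proj₁ e) h))
      }

    M₀′ : E' → Bool
    M₀′ = M₀ ∘ proj₁

    M₀′-avoids-H′ : ∀ e → M₀′ e ≡ true → ¬ VH′ (proj₁ (ends shrunk e)) × ¬ VH′ (proj₂ (ends shrunk e))
    M₀′-avoids-H′ (e , s) M₀e =
      ¬VH⇒¬VH′ (M₀-avoids-H M₀e (inj₁ refl)) (λ f X̄∈ → M₀-uncut X̄∈ M₀e (Survives-X̄⇒InCut s (inj₁ f))) ,
      ¬VH⇒¬VH′ (M₀-avoids-H M₀e (inj₂ refl)) (λ f X̄∈ → M₀-uncut X̄∈ M₀e (Survives-X̄⇒InCut s (inj₂ f)))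

    M₀′-perfect-off-H′ : ∀ x → ¬ VH′ x → ExactlyOne shrunk (λ e → (M₀′ e ≡ true) × Incident shrunk e x)
    M₀′-perfect-off-H′ (just (v , t)) v∉H with e , (M₀e , i) , unique ← M₀-perfect-off-H v∉H =
      (e , proj₁ (Incident-shrunk i t)) , (M₀e , proj₂ (Incident-shrunk i t)) , unique′
      where
      unique′ : ∀ e′ → (M₀′ e′ ≡ true) × Incident shrunk e′ (just (v , t)) → e′ ≡ (e , _)
      unique′ (e′ , _) (M₀e′ , inj₁ eq) with refl ← unique e′ (M₀e′ , inj₁ (shr≡just⇒ eq)) = Survives-irrelevant
      unique′ (e′ , _) (M₀e′ , inj₂ eq) with refl ← unique e′ (M₀e′ , inj₂ (shr≡just⇒ eq)) = Survives-irrelevant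
    M₀′-perfect-off-H′ nothing X̄∉H′ with e , (M₀e , c) , unique ← M₀-cut-once X̄∉H′ =
      (e , InCut⇒Survives c) , (M₀e , InCut⇒Incident-X̄ c) , unique′
      where
      unique′ : ∀ e′ → (M₀′ e′ ≡ true) × Incident shrunk e′ nothing → e′ ≡ (e , _)
      unique′ (e′ , s) (M₀e′ , inj₁ eq)
        with refl ← unique e′ (M₀e′ , Survives-X̄⇒InCut s (inj₁ (shr≡nothing⇒ eq))) = Survives-irrelevant
      unique′ (e′ , s) (M₀e′ , inj₂ eq)
        with refl ← unique e′ (M₀e′ , Survives-X̄⇒InCut s (inj₂ (shr≡nothing⇒ eq))) = Survives-irrelevant

    H′-conformal : Conformal shrunk H′
    H′-conformal = M₀′ , M₀′-avoids-H′ , M₀′-perfect-off-H′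

    φ′ : Fin nJ → V'
    φ′ = shr ∘ φ

    φ′-injective : ∀ a b → φ′ a ≡ φ′ b → a ≡ b
    φ′-injective a b eq with true⊎false (X (φ a))
    ... | inj₁ Xa = φ-inj a b (shr-injective eq Xa)
    ... | inj₂ Xa = φ-X̄-unique a b Xa (shr≡nothing⇒ (trans (sym eq) (shr-false Xa)))

    φ′-not-inner : ∀ f a → φ′ a ∉ innerVerts shrunk (contract (path f))
    φ′-not-inner f a i with true⊎false (X (φ a))
    ... | inj₂ Xa = X̄-image⇒¬inner f a Xa (subst (_∈ innerVerts shrunk (contract (path f))) (shr-false Xa) i)
    ... | inj₁ Xa with v , k , eq ← contract-innerVerts⁻ (path f) i =
      inner-not-branch f a (subst (_∈ innerVerts G (path f)) (sym (shr-injective (sym eq) Xa)) k)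

    contract-inner-disjoint : ∀ f g x → f ≢ g → x ∈ innerVerts shrunk (contract (path f)) →
                              x ∉ innerVerts shrunk (contract (path g))
    contract-inner-disjoint f g nothing f≢g i i′ = X̄-inner-unique f g f≢g i i′
    contract-inner-disjoint f g (just (v , t)) f≢g i i′
      with v₁ , k₁ , eq₁ ← contract-innerVerts⁻ (path f) i
         | v₂ , k₂ , eq₂ ← contract-innerVerts⁻ (path g) i′ =
      inner-disjoint f g v f≢g (subst (_∈ innerVerts G (path f)) (shr≡just⇒ eq₁) k₁)
                               (subst (_∈ innerVerts G (path g)) (shr≡just⇒ eq₂) k₂)

    H′-vertices : ∀ x → VH′ x → (Σ (Fin nJ) λ a → φ′ a ≡ x) ⊎
                                (Σ (Fin mJ) λ f → x ∈ innerVerts shrunk (contract (path f)))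
    H′-vertices nothing h = Sum.map₁ (Product.map₂ shr-false) (X̄-image⊎inner h)
    H′-vertices (just (v , t)) h with vertices v h
    ... | inj₁ (a , refl) = inj₁ (a , shr-true t)
    ... | inj₂ (f , i)    = inj₂ (f , subst (_∈ innerVerts shrunk (contract (path f))) (shr-true t)
                                             (contract-innerVerts⁺ (path f) i t))

    contract-inner⇒VH′ : ∀ f x → x ∈ innerVerts shrunk (contract (path f)) → VH′ x
    contract-inner⇒VH′ f nothing i = X̄-inner⇒∈H′ f i
    contract-inner⇒VH′ f (just (v , t)) i with v′ , k , eq ← contract-innerVerts⁻ (path f) i =
      subst (VH H) (shr≡just⇒ eq) (vertices-inner f v′ k)

    H′-bisubdivision : IsBisubdivisionOf shrunk H′ J
    H′-bisubdivision = record
      { φ                = φ′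
      ; φ-inj            = φ′-injective
      ; path             = contract ∘ path
      ; isPath           = contract-path
      ; odd              = λ f → isOdd⇒1+2k _ (contract-odd f)
      ; inner-not-branch = φ′-not-inner
      ; inner-disjoint   = contract-inner-disjoint
      ; edge-disjoint    = λ f g e f≢g k k′ →
                             edge-disjoint f g (proj₁ e) f≢g (contract-edges⁻ (path f) k)
                                                             (contract-edges⁻ (path g) k′)
      ; vertices         = H′-vertices
      ; vertices-image   = λ a → VH⇒VH′ (vertices-image a)
      ; vertices-inner   = contract-inner⇒VH′
      ; edges            = λ e h → Product.map₂ (λ k → contract-edges⁺ _ k (proj₂ e)) (edges (proj₁ e) h)
      ; edges-image      = λ f e k → edges-image f (proj₁ e) (contract-edges⁻ (path f) k)
      }

    contraction-JBased : JBased shrunk J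
    contraction-JBased = H′ , H′-conformal , H′-bisubdivision

  M₀-uncut-if-lift-crosses-on-path : IsPerfectMatching J N → e₁ ∈ pathEdges g → liftMatching N e₁ ≡ true →
                                     InCut G X e₁ → M₀ e ≡ true → ¬ InCut G X e
  M₀-uncut-if-lift-crosses-on-path {N = N} pm k l c M₀e c′
    with refl ← lift-crossing-unique pm (liftMatching-M₀ {N = N} M₀e) c′ l c = path-edge⇒¬M₀ k M₀e

  uncrossed-path-inside : X (φ (proj₁ (ends J f))) ≡ true → (∀ e → e ∈ pathEdges f → ¬ InCut G X e) →
                          OnSide true (path f)
  uncrossed-path-inside {f} t nc = All.map (λ eq → trans eq t) (uncrossed⇒OnSide (path f) nc)

  -- The index says whether the path may dip into X̄ and come back.
  data PathShape (f : Fin mJ) : Bool → Set where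
    inside : ∀ {b} → OnSide true (path f) → PathShape f b
    leaves : ∀ {b} c → Leaves (path f) c → c ∈ evens (pathEdges f) → PathShape f b
    enters : ∀ {b} c → Enters (path f) c → c ∈ evens (pathEdges f) → PathShape f b
    dips   : ∀ c₁ c₂ → Dips (path f) c₁ c₂ → OppositeParity (pathEdges f) c₁ c₂ → PathShape f true

  shape-path : ∀ {b} → PathShape f b → IsPath shrunk (contract (path f))
  shape-path {f} (inside all)     = contract-path-X (path f) all (isPath f)
  shape-path {f} (leaves _ l _)   = leaves-path l (isPath f)
  shape-path {f} (enters _ l _)   = enters-path l (isPath f)
  shape-path {f} (dips _ _ d _)   = dips-path d (isPath f)

  shape-odd : ∀ {b} → PathShape f b → oddLength (walkEdges shrunk (contract (path f))) ≡ true
  shape-odd {f} (inside all)     = trans (contract-oddLength-X (path f) all) (path-oddLength f)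
  shape-odd {f} (leaves _ l k)   = trans (proj₁ (leaves-oddLength l (path-edges-unique f)) k) (path-oddLength f)
  shape-odd {f} (enters _ l k)   = proj₁ (enters-oddLength l (path-edges-unique f)) k
  shape-odd {f} (dips _ _ d par) = trans (dips-oddLength d (path-edges-unique f) par) (path-oddLength f)

  shape-X̄∉inner : PathShape f false → nothing ∉ innerVerts shrunk (contract (path f))
  shape-X̄∉inner {f} (inside all) i = nothing∉contract-X (path f) all (Ŵ.innerVerts⊆walkVerts _ i)
  shape-X̄∉inner (leaves _ l _)     = leaves-nothing∉innerVerts l
  shape-X̄∉inner (enters _ l _)     = enters-nothing∉innerVerts l

  module H⊆X (φ⊆X : ∀ a → X (φ a) ≡ true) (uncrossed : ∀ g e → e ∈ pathEdges g → ¬ InCut G X e) where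

    inside-path : ∀ f → OnSide true (path f)
    inside-path f = uncrossed-path-inside (φ⊆X _) (uncrossed f)

    H∩X̄-empty : VH H v → X v ≢ false
    H∩X̄-empty {v} h Xv with vertices v h
    ... | inj₁ (a , refl) = not-¬ (φ⊆X a) Xv
    ... | inj₂ (f , i)    = not-¬ (All.lookup (inside-path f) (innerVerts⊆walkVerts (path f) i)) Xv

    M₀-cut-once : ExactlyOne G (λ e → (M₀ e ≡ true) × InCut G X e)
    M₀-cut-once
      with N , pm ← somePerfectMatching
      with e , (l , c) , unique ← tight _ (liftMatching-perfect pm)
      with liftMatching⇒ {N = N} l
    ... | inj₁ M₀e     = e , (M₀e , c) , λ e′ (M₀e′ , c′) → unique e′ (liftMatching-M₀ {N = N} M₀e′ , c′)
    ... | inj₂ (g , k) = ⊥-elim (uncrossed g e (alternate⊆ (N g) _ k) c)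

    facts : ContractionFacts
    facts = record
      { X̄∈H′          = ⊥
      ; H-meets-X̄     = H∩X̄-empty
      ; M₀-uncut       = λ ()
      ; M₀-cut-once    = λ _ → M₀-cut-once
      ; contract-path  = λ f → shape-path (inside {b = false} (inside-path f))
      ; contract-odd   = λ f → shape-odd (inside {b = false} (inside-path f))
      ; X̄-image⊎inner  = λ ()
      ; X̄-inner⇒∈H′   = λ f → shape-X̄∉inner (inside (inside-path f))
      ; X̄-image⇒¬inner = λ f a Xa → ⊥-elim (not-¬ (φ⊆X a) Xa)
      ; X̄-inner-unique = λ f g _ _ → shape-X̄∉inner (inside (inside-path g))
      }

  module DippingPath
    (φ⊆X : ∀ a → X (φ a) ≡ true) (f₀ : Fin mJ) (c₁ : Fin m) (k₁ : c₁ ∈ pathEdges f₀) (cut₁ : InCut G X c₁)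
    where

    private
      second : Σ (Fin m) λ c₂ → c₂ ∈ pathEdges f₀ × InCut G X c₂ × c₂ ≢ c₁
      second = second-crossing (path f₀) (trans (φ⊆X _) (sym (φ⊆X _))) (path-edges-unique f₀) k₁ cut₁

    c₂ : Fin m
    c₂ = proj₁ second

    k₂ : c₂ ∈ pathEdges f₀
    k₂ = proj₁ (proj₂ second)

    cut₂ : InCut G X c₂
    cut₂ = proj₁ (proj₂ (proj₂ second))

    parity₁ parity₂ : Bool
    parity₁ = proj₁ (∈⇒∈alternate _ k₁)
    parity₂ = proj₁ (∈⇒∈alternate _ k₂)

    a₁ : c₁ ∈ alternate parity₁ (pathEdges f₀)
    a₁ = proj₂ (∈⇒∈alternate _ k₁)

    a₂ : c₂ ∈ alternate parity₂ (pathEdges f₀)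
    a₂ = proj₂ (∈⇒∈alternate _ k₂)

    -- Otherwise c₁ and c₂ would lie in one lift, which meets the tight cut only once.
    parity₁≢parity₂ : parity₁ ≢ parity₂
    parity₁≢parity₂ eq with N , pm , Nf₀ ← perfectMatching-with f₀ parity₁ =
      proj₂ (proj₂ (proj₂ second))
        (lift-crossing-unique pm (liftMatching-path {N = N} (trans Nf₀ eq) a₂) cut₂
                                 (liftMatching-path {N = N} Nf₀ a₁) cut₁)

    lift-crosses-at-c₁⊎c₂ : ∀ N → Σ (Fin m) λ c → (c ≡ c₁ ⊎ c ≡ c₂) × liftMatching N c ≡ true × InCut G X c
    lift-crosses-at-c₁⊎c₂ N with N f₀ ≟ᵇ parity₁
    ... | yes Nf₀ = c₁ , inj₁ refl , liftMatching-path {N = N} Nf₀ a₁ , cut₁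
    ... | no  Nf₀ =
      c₂ , inj₂ refl , liftMatching-path {N = N} (trans (¬-not Nf₀) (sym (¬-not (≢-sym parity₁≢parity₂)))) a₂ , cut₂

    crossings-on-H : ∀ g e → e ∈ pathEdges g → InCut G X e → e ≡ c₁ ⊎ e ≡ c₂
    crossings-on-H g e k cut
      with b , a ← ∈⇒∈alternate _ k
      with N , pm , Ng ← perfectMatching-with g b
      with c , c≡ , l , cut′ ← lift-crosses-at-c₁⊎c₂ N
      with refl ← lift-crossing-unique pm (liftMatching-path {N = N} Ng a) cut l cut′ = c≡

    on-f₀ : e ≡ c₁ ⊎ e ≡ c₂ → e ∈ pathEdges f₀
    on-f₀ (inj₁ refl) = k₁
    on-f₀ (inj₂ refl) = k₂

    other-path-inside : g ≢ f₀ → OnSide true (path g)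
    other-path-inside {g} g≢f₀ = uncrossed-path-inside (φ⊆X _)
      (λ e k cut → path-edges-disjoint g≢f₀ k (on-f₀ (crossings-on-H g e k cut)) refl)

    f₀-dips : Dips (path f₀) c₁ c₂ ⊎ Dips (path f₀) c₂ c₁
    f₀-dips = dips-intro (path f₀) (φ⊆X _) (φ⊆X _) (path-edges-unique f₀) k₁ cut₁ (crossings-on-H f₀)

    opposite : OppositeParity (pathEdges f₀) c₁ c₂
    opposite = alternate⇒OppositeParity parity₁ parity₂ a₁ a₂ parity₁≢parity₂

    shape : ∀ g → PathShape g true
    shape g with g Fin.≟ f₀
    ... | no  g≢f₀ = inside (other-path-inside g≢f₀)
    ... | yes refl =
      Sum.[ (λ d → dips c₁ c₂ d opposite) , (λ d → dips c₂ c₁ d (OppositeParity-sym opposite)) ] f₀-dips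

    X̄-inner-f₀ : nothing ∈ innerVerts shrunk (contract (path f₀))
    X̄-inner-f₀ = Sum.[ dips-nothing∈innerVerts , dips-nothing∈innerVerts ] f₀-dips

    X̄-inner-unique : ∀ f g → f ≢ g → nothing ∈ innerVerts shrunk (contract (path f)) →
                     nothing ∉ innerVerts shrunk (contract (path g))
    X̄-inner-unique f g f≢g i i′ with f Fin.≟ f₀
    ... | yes refl = nothing∉contract-X (path g) (other-path-inside (≢-sym f≢g)) (Ŵ.innerVerts⊆walkVerts _ i′)
    ... | no  f≢f₀ = nothing∉contract-X (path f) (other-path-inside f≢f₀) (Ŵ.innerVerts⊆walkVerts _ i)

    M₀-uncut : M₀ e ≡ true → ¬ InCut G X e
    M₀-uncut with N , pm ← somePerfectMatching with c , c≡ , l , cut ← lift-crosses-at-c₁⊎c₂ N =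
      M₀-uncut-if-lift-crosses-on-path pm (on-f₀ c≡) l cut

    facts : ContractionFacts
    facts = record
      { X̄∈H′          = ⊤
      ; H-meets-X̄     = λ _ _ → tt
      ; M₀-uncut       = λ _ → M₀-uncut
      ; M₀-cut-once    = λ X̄∉H′ → ⊥-elim (X̄∉H′ tt)
      ; contract-path  = shape-path ∘ shape
      ; contract-odd   = shape-odd ∘ shape
      ; X̄-image⊎inner  = λ _ → inj₂ (f₀ , X̄-inner-f₀)
      ; X̄-inner⇒∈H′   = λ _ _ → tt
      ; X̄-image⇒¬inner = λ f a Xa → ⊥-elim (not-¬ (φ⊆X a) Xa)
      ; X̄-inner-unique = X̄-inner-unique
      }

  module BranchInX̄ (a : Fin nJ) (Xa : X (φ a) ≡ false) where

    other-φ-in-X : ∀ b → b ≢ a → X (φ b) ≡ true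
    other-φ-in-X b b≢a with true⊎false (X (φ b))
    ... | inj₁ t = t
    ... | inj₂ f = ⊥-elim (b≢a (φ-X̄-unique b a f Xa))

    other-end-in-X₁ : proj₁ (ends J g) ≡ a → X (φ (proj₂ (ends J g))) ≡ true
    other-end-in-X₁ {g} eq = other-φ-in-X _ (λ eq₂ → loopless J g (trans eq (sym eq₂)))

    other-end-in-X₂ : proj₂ (ends J g) ≡ a → X (φ (proj₁ (ends J g))) ≡ true
    other-end-in-X₂ {g} eq = other-φ-in-X _ (λ eq₁ → loopless J g (trans eq₁ (sym eq)))

    path-crossing : Incident J g a → Σ (Fin m) λ c → c ∈ pathEdges g × InCut G X c
    path-crossing {g} (inj₁ eq) = crossing-edge (path g) λ d →
      not-¬ (other-end-in-X₁ eq) (trans (sym d) (trans (cong (X ∘ φ) eq) Xa))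
    path-crossing {g} (inj₂ eq) = crossing-edge (path g) λ d →
      not-¬ (other-end-in-X₂ eq) (trans d (trans (cong (X ∘ φ) eq) Xa))

    -- Were e in an odd position, a perfect matching of J through a suitable other edge at a
    -- would lift to a matching containing both e and a crossing edge on the path of a third
    -- edge at a.
    crossing-at-a-even : Incident J g a → e ∈ pathEdges g → InCut G X e → e ∈ evens (pathEdges g)
    crossing-at-a-even {g} i k cut with ∈⇒∈evens⊎∈odds _ k
    ... | inj₁ even = even
    ... | inj₂ odd
      with h , h′ , ih , ih′ , h≢g , h′≢g , h≢h′ ← two-other-edges a g
      with c′ , k′ , cut′ ← path-crossing ih′
      with ∈⇒∈evens⊎∈odds _ k′
    ...   | inj₂ odd′ with N , pm , Nh ← perfectMatching-with h true =
      ⊥-elim (path-edges-disjoint (≢-sym h′≢g) k k′ (lift-crossing-unique pm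
        (liftMatching-path {N = N} (matched-edge-excludes pm i ih (≢-sym h≢g) Nh) odd) cut
        (liftMatching-path {N = N} (matched-edge-excludes pm ih′ ih (≢-sym h≢h′) Nh) odd′) cut′))
    ...   | inj₁ even′ with N , pm , Nh′ ← perfectMatching-with h′ true =
      ⊥-elim (path-edges-disjoint (≢-sym h′≢g) k k′ (lift-crossing-unique pm
        (liftMatching-path {N = N} (matched-edge-excludes pm i ih′ (≢-sym h′≢g) Nh′) odd) cut
        (liftMatching-path {N = N} Nh′ even′) cut′))

    crossing-at-a-unique : Incident J g a → e₁ ∈ pathEdges g → InCut G X e₁ →
                           e₂ ∈ pathEdges g → InCut G X e₂ → e₂ ≡ e₁
    crossing-at-a-unique {g} i k₁ cut₁ k₂ cut₂ with N , pm , Ng ← perfectMatching-with g true =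
      lift-crossing-unique pm (liftMatching-path {N = N} Ng (crossing-at-a-even i k₂ cut₂)) cut₂
                              (liftMatching-path {N = N} Ng (crossing-at-a-even i k₁ cut₁)) cut₁

    uncrossed-away-from-a : ¬ Incident J g a → e ∈ pathEdges g → ¬ InCut G X e
    uncrossed-away-from-a {g} ¬i k cut
      with b , alt ← ∈⇒∈alternate _ k
      with N , pm , Ng ← perfectMatching-with g b
      with h , (Nh , ih) , _ ← pm a
      with c′ , k′ , cut′ ← path-crossing ih =
      path-edges-disjoint (λ { refl → ¬i ih }) k k′ (lift-crossing-unique pm
        (liftMatching-path {N = N} Ng alt) cut (liftMatching-path {N = N} Nh (crossing-at-a-even ih k′ cut′)) cut′)

    shape : ∀ g → PathShape g false
    shape g with proj₁ (ends J g) Fin.≟ a | proj₂ (ends J g) Fin.≟ a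
    ... | yes eq | _ with c , k , cut ← path-crossing (inj₁ eq) =
      leaves c (leaves-intro (path g) (trans (cong (X ∘ φ) eq) Xa) (other-end-in-X₁ eq) (path-edges-unique g)
                             (λ _ k′ cut′ → crossing-at-a-unique (inj₁ eq) k cut k′ cut′))
               (crossing-at-a-even (inj₁ eq) k cut)
    ... | no _ | yes eq with c , k , cut ← path-crossing (inj₂ eq) =
      enters c (enters-intro (path g) (other-end-in-X₂ eq) (trans (cong (X ∘ φ) eq) Xa) (path-edges-unique g)
                             (λ _ k′ cut′ → crossing-at-a-unique (inj₂ eq) k cut k′ cut′))
               (crossing-at-a-even (inj₂ eq) k cut)
    ... | no ne₁ | no ne₂ =
      inside (uncrossed-path-inside (other-φ-in-X _ ne₁) (λ _ → uncrossed-away-from-a Sum.[ ne₁ , ne₂ ]))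

    M₀-uncut : M₀ e ≡ true → ¬ InCut G X e
    M₀-uncut
      with N , pm ← somePerfectMatching
      with h , (Nh , ih) , _ ← pm a
      with c , k , cut ← path-crossing ih =
      M₀-uncut-if-lift-crosses-on-path pm k (liftMatching-path {N = N} Nh (crossing-at-a-even ih k cut)) cut

    facts : ContractionFacts
    facts = record
      { X̄∈H′          = ⊤
      ; H-meets-X̄     = λ _ _ → tt
      ; M₀-uncut       = λ _ → M₀-uncut
      ; M₀-cut-once    = λ X̄∉H′ → ⊥-elim (X̄∉H′ tt)
      ; contract-path  = shape-path ∘ shape
      ; contract-odd   = shape-odd ∘ shape
      ; X̄-image⊎inner  = λ _ → inj₁ (a , Xa)
      ; X̄-inner⇒∈H′   = λ _ _ → tt
      ; X̄-image⇒¬inner = λ f _ _ → shape-X̄∉inner (shape f)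
      ; X̄-inner-unique = λ _ g _ _ → shape-X̄∉inner (shape g)
      }

  shrunk-JBased-φ⊆X : (∀ a → X (φ a) ≡ true) → JBased shrunk J
  shrunk-JBased-φ⊆X φ⊆X
    with Fin.any? (λ g → Any.any? (λ e → ¬? (X (proj₁ (ends G e)) ≟ᵇ X (proj₂ (ends G e)))) (pathEdges g))
  ... | yes (g , crossing) with c , k , cut ← find crossing =
    contraction-JBased (DippingPath.facts φ⊆X g c k cut)
  ... | no ¬crossing = contraction-JBased (H⊆X.facts φ⊆X (λ g e k cut → ¬crossing (g , lose k cut)))

  shrunk-JBased : JBased shrunk J
  shrunk-JBased with Fin.any? (λ a → X (φ a) ≟ᵇ false)
  ... | yes (a , Xa) = contraction-JBased (BranchInX̄.facts a Xa)
  ... | no  ¬X̄     = shrunk-JBased-φ⊆X (λ a → ¬-not (λ Xa → ¬X̄ (a , Xa)))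

corollary37 :
    {nJ mJ : ℕ} (J : Graph (Fin nJ) (Fin mJ)) →
    MatchingCovered J → MinDegree≥3 J →
    {n m : ℕ} (G : Graph (Fin n) (Fin m)) → MatchingCovered G →
    (H : Subgraph G) → Conformal G H → IsBisubdivisionOf G H J →
    (X : Fin n → Bool) → TightCut G X → NontrivialCut G X →
    (∀ u v → Branch G H u → Branch G H v → X u ≡ false → X v ≡ false → u ≡ v) →
    JBased (shrinkComplement G X) J
corollary37 J mcJ δJ G _ H conf bd X tight _ X̄-branch-unique =
  ShrinkingTightCut.shrunk-JBased mcJ δJ conf bd X tight X̄-branch-unique
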